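{- Let $1\le k\le n$ be integers and $\lambda$ a partition of $n$. Then $$\sum_{s\in M^\lambda_k}t^{\rho(s)}=\sum_{\substack{D\in D_n\\ \lambda(D)=\lambda}}t^{\operatorname{area}(D)}H_{n-k}(D),$$ where for a Dyck path $D$ with area sequence $(\alpha_1,\dots,\alpha_n)$, $H_{n-k}(D)$ is the coefficient of $w^{n-k}$ in $(1+w)\prod_{2\le i\le n,\ \alpha_{i-1}=\alpha_i-1}\big(1+w\,t^{ -\alpha_i}\big)$.
   Context: $M^\lambda_k$ is the set of sequences $s=((a_1,b_1),\dots,(a_{k+1},b_{k+1}))$ of pairs of nonnegative integers with $a_1=0$, $(b_1,\dots,b_{k+1})$ a rearrangement of $\lambda_1,\dots,\lambda_{\ell(\lambda)},0^{k+1-\ell(\lambda)}$ (empty if $\ell(\lambda)>k+1$), and $a_{i+1}<a_i+b_i$ for all $i$; $\rho(s)=a_1+\cdots+a_{k+1}$. $D_n$ is the set of Dyck paths from $(0,0)$ to $(n,n)$ (North and East unit steps, weakly above $y=x$). Reading rows bottom to top, $\alpha_i$ is the number of full cells in row $i$ between the path and the diagonal; $\operatorname{area}(D)=\sum\alpha_i$. $\lambda(D)$ is the partition of $n$ given by the lengths of the maximal vertical segments of $D$. -}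

module Defs where

open import Data.Bool using (Bool; true; false; if_then_else_)
open import Data.Nat using (ℕ; zero; suc; _+_; _∸_; _≤_; _≥_)
import Data.Nat as ℕ
open import Data.Nat.Properties using (≤-decTotalOrder)
open import Data.Integer using (ℤ; +_; -_)
import Data.Integer as ℤ
open import Data.Nat.ListAction using (sum)
open import Data.List using (List; []; _∷_; _++_; map; concatMap; upTo; length; replicate; reverse; filter; filterᵇ; and)
open import Data.List.Relation.Unary.All using (All)
open import Data.List.Relation.Unary.Linked using (Linked)
open import Data.List.Sort.MergeSort ≤-decTotalOrder using (sort)
open import Data.List.Properties using (≡-dec)
open import Data.Product using (_×_; _,_; proj₁; proj₂)
open import Relation.Nullary.Decidable using (⌊_⌋)
open import Relation.Binary.PropositionalEquality using (_≡_)

IsPartition : ℕ → List ℕ → Set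
IsPartition n la = (sum la ≡ n) × All (λ x → 1 ≤ x) la × Linked _≥_ la

-- Polynomials (Laurent polynomials) in t with coefficients in ℕ are
-- represented as the multiset (list) of exponents of their monomials:
-- the list [e₁, …, e_m] stands for t^e₁ + ⋯ + t^e_m.

LPoly : Set
LPoly = List ℤ

coeff : ℤ → LPoly → ℕ
coeff e p = length (filter (λ x → x ℤ.≟ e) p)

_≈P_ : LPoly → LPoly → Set
p ≈P q = ∀ (e : ℤ) → coeff e p ≡ coeff e q

-- Bivariate polynomials in w (exponent ℕ) and t (exponent ℤ), again as
-- the multiset of monomials w^a t^b, represented by pairs (a , b).
BPoly : Set
BPoly = List (ℕ × ℤ)

_*B_ : BPoly → BPoly → BPoly
p *B q = concatMap (λ m → map (λ m' → (proj₁ m + proj₁ m' , proj₂ m ℤ.+ proj₂ m')) q) p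

oneB : BPoly
oneB = (0 , + 0) ∷ []

coeffW : ℕ → BPoly → LPoly
coeffW j p = map proj₂ (filterᵇ (λ m → ⌊ proj₁ m ℕ.≟ j ⌋) p)

shiftT : ℤ → LPoly → LPoly
shiftT e = map (λ x → e ℤ.+ x)

allLists : ℕ → ℕ → List (List ℕ)
allLists zero    N = [] ∷ []
allLists (suc m) N = concatMap (λ x → map (x ∷_) (allLists m N)) (upTo (suc N))

isRearrangement : List ℕ → List ℕ → Bool
isRearrangement xs ys = ⌊ ≡-dec ℕ._≟_ (sort xs) (sort ys) ⌋

-- all sequences (b₁,…,b_{k+1}) that are rearrangements of
-- λ₁,…,λ_ℓ,0^{k+1-ℓ}  (none when ℓ > k+1, by length).
-- Every such entry is ≤ n, with n = sum λ.
bSeqs : List ℕ → ℕ → List (List ℕ)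
bSeqs la k = filterᵇ (λ bs → isRearrangement bs (la ++ replicate (suc k ∸ length la) 0))
                    (allLists (suc k) (sum la))

aSeqs : ℕ → List ℕ → List (List ℕ)
aSeqs a []            = [] ∷ []
aSeqs a (b ∷ [])      = (a ∷ []) ∷ []
aSeqs a (b ∷ b' ∷ bs) = concatMap (λ a' → map (a ∷_) (aSeqs a' (b' ∷ bs))) (upTo (a + b))

zipPairs : List ℕ → List ℕ → List (ℕ × ℕ)
zipPairs (x ∷ xs) (y ∷ ys) = (x , y) ∷ zipPairs xs ys
zipPairs _        _        = []

-- enumeration of M^λ_k (each element exactly once)
M : List ℕ → ℕ → List (List (ℕ × ℕ))
M la k = concatMap (λ bs → map (λ as → zipPairs as bs) (aSeqs 0 bs)) (bSeqs la k)

ρ : List (ℕ × ℕ) → ℕ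
ρ s = sum (map proj₁ s)

-- Dyck paths: words in N (= true) and E (= false) steps.

allWords : ℕ → List (List Bool)
allWords zero    = [] ∷ []
allWords (suc m) = concatMap (λ w → (true ∷ w) ∷ (false ∷ w) ∷ []) (allWords m)

weaklyAbove : ℕ → ℕ → List Bool → Bool
weaklyAbove u r []           = ⌊ u ℕ.≟ r ⌋
weaklyAbove u r (true ∷ w)   = weaklyAbove (suc u) r w
weaklyAbove u r (false ∷ w)  = ⌊ suc r ℕ.≤? u ⌋ Data.Bool.∧ weaklyAbove u (suc r) w
  where import Data.Bool

Dyck : ℕ → List (List Bool)
Dyck n = filterᵇ (weaklyAbove 0 0) (allWords (n + n))

-- area sequence (α₁,…,α_n), rows read bottom to top:
-- α_i = (i-1) - (number of E steps before the i-th N step),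
-- the number of full cells in row i between the path and the diagonal.
areaSeqFrom : ℕ → ℕ → List Bool → List ℕ
areaSeqFrom u r []          = []
areaSeqFrom u r (true ∷ w)  = (u ∸ r) ∷ areaSeqFrom (suc u) r w
areaSeqFrom u r (false ∷ w) = areaSeqFrom u (suc r) w

areaSeq : List Bool → List ℕ
areaSeq = areaSeqFrom 0 0

area : List Bool → ℕ
area D = sum (areaSeq D)

vRunsFrom : ℕ → List Bool → List ℕ
vRunsFrom zero    []          = []
vRunsFrom (suc c) []          = suc c ∷ []
vRunsFrom c       (true ∷ w)  = vRunsFrom (suc c) w
vRunsFrom zero    (false ∷ w) = vRunsFrom zero w
vRunsFrom (suc c) (false ∷ w) = suc c ∷ vRunsFrom zero w

partitionOf : List Bool → List ℕ
partitionOf D = reverse (sort (vRunsFrom 0 D))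

prodFactors : List ℕ → BPoly
prodFactors []            = oneB
prodFactors (x ∷ [])      = oneB
prodFactors (x ∷ y ∷ αs)  =
  (if ⌊ y ℕ.≟ suc x ⌋
     then ((0 , + 0) ∷ (1 , - (+ y)) ∷ [])
     else oneB)
  *B prodFactors (y ∷ αs)

HPoly : List Bool → BPoly
HPoly D = ((0 , + 0) ∷ (1 , + 0) ∷ []) *B prodFactors (areaSeq D)

H : ℕ → List Bool → LPoly
H j D = coeffW j (HPoly D)

LHS : List ℕ → ℕ → LPoly
LHS la k = map (λ s → + ρ s) (M la k)

RHS : ℕ → List ℕ → ℕ → LPoly
RHS n la k =
  concatMap (λ D → shiftT (+ area D) (H (n ∸ k) D))
            (filterᵇ (λ D → ⌊ ≡-dec ℕ._≟_ (partitionOf D) la ⌋) (Dyck n))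

-- Both sides are refined by the list κ of nonzero parts in order of appearance: the nonzero bᵢ of
-- s ∈ M^λ_k, and the vertical run lengths of D from bottom to top.  Only lists κ rearranging λ occur,
-- so it suffices to compare the two sides for each κ, recording by a second variable u the number of
-- zero bᵢ, resp. the rows with αᵢ = αᵢ₋₁ + 1.
-- After multiplying out t^area(D) H(D), a run of length c whose lowest row has area a contributes
-- t^a (t^(a+1) + u) ⋯ (t^(a+c-1) + u), and the next run starts with area below a + c; so the Dyck
-- paths give (1 + u) f₁(κ) with f_B(c ∷ κ) = Σ_{a<B} t^a ∏_{a<i<a+c} (t^i + u) f_{a+c}(κ).
-- Splitting off a₁ < B and following how the count changes from B to B + 1 shows that the sequences
-- are counted by ∏_{i<B} (1 + u t^i) g_B(κ), where g is f with every t^i + u replaced by 1 + u t^i.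
-- So g is f with the power of u reversed, and the coefficient of u^(k+1-ℓ(κ)) on the left is the
-- coefficient of u^(n-k) on the right.

module Submission where

open import Defs
open import Algebra.Properties.CommutativeSemigroup using (interchange)
open import Data.Bool using (Bool; true; false; if_then_else_; _∧_)
open import Data.Integer as ℤ using (ℤ; +_; -[1+_])
open import Data.Integer.Tactic.RingSolver using (solve-∀)
open import Data.List using (List; []; _∷_; _++_; map; concatMap; upTo; applyUpTo; length; filterᵇ; _∷ʳ_; replicate; reverse; deduplicate)
open import Data.List.Membership.Propositional using (_∈_)
open import Data.List.Membership.Propositional.Properties using (∈-map⁺; ∈-++⁺ˡ; ∈-++⁺ʳ; ∈-deduplicate⁺)
import Data.List.Properties as List
open import Data.List.Relation.Binary.Permutation.Propositional
  using (_↭_; refl; prep; swap; ↭-refl; ↭-sym; ↭-trans; ↭-reflexive; ↭⇒↭ₛ) renaming (trans to ↭-transitive)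
import Data.List.Relation.Binary.Permutation.Propositional.Properties as Perm
import Data.List.Relation.Binary.Permutation.Homogeneous as Homogeneous
open import Data.List.Relation.Binary.Pointwise using (Pointwise-≡⇒≡)
open import Data.List.Relation.Unary.All using (All; []; _∷_)
open import Data.List.Relation.Unary.Any using (here; there)
import Data.List.Relation.Unary.All as All
import Data.List.Relation.Unary.All.Properties as All
open import Data.List.Relation.Unary.Linked using (Linked; []; [-]; _∷_)
open import Data.List.Relation.Unary.Linked.Properties using (Linked⇒All)
open import Data.List.Relation.Unary.Sorted.TotalOrder.Properties using (↗↭↗⇒≋)
open import Data.List.Relation.Unary.Unique.Propositional using (Unique; []; _∷_)
open import Data.List.Relation.Unary.Unique.DecPropositional.Properties using (deduplicate-!)
open import Data.Maybe using (Maybe; just; nothing)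
open import Data.Nat using (ℕ; zero; suc; _+_; _∸_; _≤_; _≥_; _<_; z≤n; s≤s)
open import Data.Nat.ListAction using (sum)
open import Data.Nat.ListAction.Properties using (sum-↭)
import Data.Nat.Properties as ℕ
open import Data.List.Sort.MergeSort ℕ.≤-decTotalOrder using (sort)
import Data.List.Sort.MergeSort.Properties ℕ.≤-decTotalOrder as Sort
open import Data.Product using (_×_; _,_; proj₁; proj₂)
open import Data.Sum using (inj₁; inj₂)
open import Function.Bundles using (mk⇔)
open import Relation.Binary.Bundles using (Setoid)
open import Relation.Binary.PropositionalEquality using (_≡_; _≢_; refl; sym; trans; cong; cong₂; subst; module ≡-Reasoning)
import Relation.Binary.Reasoning.Setoid as SetoidReasoning
open import Relation.Nullary using (¬_)
open import Relation.Nullary.Decidable using (Dec; ⌊_⌋; yes; no; isYes≗does; dec-true; dec-false; does-⇔)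

⌊⌋-⇔ : {A B : Set} (a? : Dec A) (b? : Dec B) → (A → B) → (B → A) → ⌊ a? ⌋ ≡ ⌊ b? ⌋
⌊⌋-⇔ a? b? f g = trans (isYes≗does a?) (trans (does-⇔ (mk⇔ f g) a? b?) (sym (isYes≗does b?)))

⌊⌋-true : {A : Set} (a? : Dec A) → A → ⌊ a? ⌋ ≡ true
⌊⌋-true a? a = trans (isYes≗does a?) (dec-true a? a)

⌊⌋-false : {A : Set} (a? : Dec A) → ¬ A → ⌊ a? ⌋ ≡ false
⌊⌋-false a? ¬a = trans (isYes≗does a?) (dec-false a? ¬a)

infixr 10 [_]·_

[_]·_ : Bool → ℕ → ℕ
[ true  ]· n = n
[ false ]· n = 0

[]·-zero : ∀ b → [ b ]· 0 ≡ 0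
[]·-zero true  = refl
[]·-zero false = refl

[]·-+ : ∀ b m n → [ b ]· (m + n) ≡ [ b ]· m + [ b ]· n
[]·-+ true  m n = refl
[]·-+ false m n = refl

[]·-∧ : ∀ b c n → [ b ∧ c ]· n ≡ [ b ]· [ c ]· n
[]·-∧ true  c n = refl
[]·-∧ false c n = refl

[]·-comm : ∀ b c n → [ b ]· [ c ]· n ≡ [ c ]· [ b ]· n
[]·-comm true  c     n = refl
[]·-comm false true  n = refl
[]·-comm false false n = refl

private variable A B : Set

∑ : List A → (A → ℕ) → ℕ
∑ []       f = 0
∑ (x ∷ xs) f = f x + ∑ xs f

infixr 10 ∑
syntax ∑ xs (λ x → f) = ∑[ x ∈ xs ] f

∑-cong : ∀ (xs : List A) {f g : A → ℕ} → (∀ x → f x ≡ g x) → ∑ xs f ≡ ∑ xs g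
∑-cong []       f≗g = refl
∑-cong (x ∷ xs) f≗g = cong₂ _+_ (f≗g x) (∑-cong xs f≗g)

∑-cong-All : ∀ {P : A → Set} {xs} {f g : A → ℕ} → All P xs → (∀ {x} → P x → f x ≡ g x) → ∑ xs f ≡ ∑ xs g
∑-cong-All []         f≗g = refl
∑-cong-All (px ∷ pxs) f≗g = cong₂ _+_ (f≗g px) (∑-cong-All pxs f≗g)

∑-zero : ∀ (xs : List A) → ∑[ x ∈ xs ] 0 ≡ 0
∑-zero []       = refl
∑-zero (x ∷ xs) = ∑-zero xs

∑-++ : ∀ (xs ys : List A) f → ∑ (xs ++ ys) f ≡ ∑ xs f + ∑ ys f
∑-++ []       ys f = refl
∑-++ (x ∷ xs) ys f = trans (cong (_+_ (f x)) (∑-++ xs ys f)) (sym (ℕ.+-assoc (f x) _ _))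

∑-∷ʳ : ∀ (xs : List A) x f → ∑ (xs ∷ʳ x) f ≡ ∑ xs f + f x
∑-∷ʳ xs x f = trans (∑-++ xs (x ∷ []) f) (cong (_+_ (∑ xs f)) (ℕ.+-identityʳ (f x)))

∑-+ : ∀ (xs : List A) f g → ∑[ x ∈ xs ] (f x + g x) ≡ ∑ xs f + ∑ xs g
∑-+ []       f g = refl
∑-+ (x ∷ xs) f g = trans (cong (_+_ (f x + g x)) (∑-+ xs f g)) (interchange ℕ.+-commutativeSemigroup (f x) (g x) (∑ xs f) (∑ xs g))

∑-[]· : ∀ b (xs : List A) f → ∑[ x ∈ xs ] [ b ]· f x ≡ [ b ]· ∑ xs f
∑-[]· true  xs f = refl
∑-[]· false xs f = ∑-zero xs

∑-filterᵇ : ∀ (p : A → Bool) xs f → ∑ (filterᵇ p xs) f ≡ ∑[ x ∈ xs ] [ p x ]· f x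
∑-filterᵇ p []       f = refl
∑-filterᵇ p (x ∷ xs) f with p x
... | true  = cong (_+_ (f x)) (∑-filterᵇ p xs f)
... | false = ∑-filterᵇ p xs f

∑-map : ∀ (g : A → B) xs (f : B → ℕ) → ∑ (map g xs) f ≡ ∑[ x ∈ xs ] f (g x)
∑-map g []       f = refl
∑-map g (x ∷ xs) f = cong (_+_ (f (g x))) (∑-map g xs f)

∑-concatMap : ∀ (g : A → List B) xs (f : B → ℕ) → ∑ (concatMap g xs) f ≡ ∑[ x ∈ xs ] ∑ (g x) f
∑-concatMap g []       f = refl
∑-concatMap g (x ∷ xs) f = trans (∑-++ (g x) _ f) (cong (_+_ (∑ (g x) f)) (∑-concatMap g xs f))

∑-comm : ∀ (xs : List A) (ys : List B) (f : A → B → ℕ) → ∑[ x ∈ xs ] ∑[ y ∈ ys ] f x y ≡ ∑[ y ∈ ys ] ∑[ x ∈ xs ] f x y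
∑-comm []       ys f = sym (∑-zero ys)
∑-comm (x ∷ xs) ys f = trans (cong (_+_ (∑ ys (f x))) (∑-comm xs ys f)) (sym (∑-+ ys (f x) _))

∑-upTo-suc : ∀ n f → ∑ (upTo (suc n)) f ≡ ∑ (upTo n) f + f n
∑-upTo-suc n f = trans (cong (λ xs → ∑ xs f) (sym (List.upTo-∷ʳ n))) (∑-∷ʳ (upTo n) n f)

∑-applyUpTo-suc : ∀ n f → ∑ (applyUpTo suc n) f ≡ ∑[ y ∈ upTo n ] f (suc y)
∑-applyUpTo-suc n f = trans (cong (λ xs → ∑ xs f) (sym (List.map-applyUpTo (λ x → x) suc n))) (∑-map suc (upTo n) f)

-- Series in u and t

-- Series i e is the coefficient of u^i t^e.
Series : Set
Series = ℤ → ℤ → ℕ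

infix 4 _≐_

record _≐_ (P Q : Series) : Set where
  constructor coeffwise
  field at : ∀ i e → P i e ≡ Q i e
open _≐_ public

≐-setoid : Setoid _ _
≐-setoid = record
  { Carrier       = Series
  ; _≈_           = _≐_
  ; isEquivalence = record
    { refl  = coeffwise λ i e → refl
    ; sym   = λ p → coeffwise λ i e → sym (at p i e)
    ; trans = λ p q → coeffwise λ i e → trans (at p i e) (at q i e)
    }
  }

open Setoid ≐-setoid public using () renaming (refl to ≐-refl; sym to ≐-sym; trans to ≐-trans; reflexive to ≐-reflexive)
module ≐-Reasoning = SetoidReasoning ≐-setoid

infixl 6 _⊕_
infixr 7 t^_·_ u·_

_⊕_ : Series → Series → Series
(P ⊕ Q) i e = P i e + Q i e

𝟘 : Series
𝟘 i e = 0

δ : ℤ → ℤ → ℕ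
δ x y = [ ⌊ x ℤ.≟ y ⌋ ]· 1

𝟙 : Series
𝟙 i e = [ ⌊ i ℤ.≟ + 0 ⌋ ]· δ e (+ 0)

t^_·_ : ℤ → Series → Series
(t^ a · P) i e = P i (e ℤ.- a)

u·_ : Series → Series
(u· P) i e = P (i ℤ.- + 1) e

U : ℤ → Series → Series
U j P = P ⊕ u· t^ j · P

W : ℤ → Series → Series
W j P = t^ j · P ⊕ u· P

∏U : ℕ → ℕ → Series → Series
∏U lo zero    P = P
∏U lo (suc n) P = U (+ lo) (∏U (suc lo) n P)

⨁< : ℕ → (ℕ → Series) → Series
⨁< B F i e = ∑[ a ∈ upTo B ] F a i e

infix 5 ⨁<
syntax ⨁< B (λ a → F) = ⨁[ a < B ] F

⊕-cong : ∀ {P P′ Q Q′} → P ≐ P′ → Q ≐ Q′ → P ⊕ Q ≐ P′ ⊕ Q′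
⊕-cong p q = coeffwise λ i e → cong₂ _+_ (at p i e) (at q i e)

⊕-congˡ : ∀ P {Q Q′} → Q ≐ Q′ → P ⊕ Q ≐ P ⊕ Q′
⊕-congˡ P q = coeffwise λ i e → cong (_+_ (P i e)) (at q i e)

t^-cong : ∀ a {P Q} → P ≐ Q → t^ a · P ≐ t^ a · Q
t^-cong a p = coeffwise λ i e → at p i (e ℤ.- a)

U-cong : ∀ j {P Q} → P ≐ Q → U j P ≐ U j Q
U-cong j p = coeffwise λ i e → cong₂ _+_ (at p i e) (at p (i ℤ.- + 1) (e ℤ.- j))

W-cong : ∀ j {P Q} → P ≐ Q → W j P ≐ W j Q
W-cong j p = coeffwise λ i e → cong₂ _+_ (at p i (e ℤ.- j)) (at p (i ℤ.- + 1) e)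

∏U-cong : ∀ lo n {P Q} → P ≐ Q → ∏U lo n P ≐ ∏U lo n Q
∏U-cong lo zero    p = p
∏U-cong lo (suc n) p = U-cong (+ lo) (∏U-cong (suc lo) n p)

⨁-cong : ∀ B {F G : ℕ → Series} → (∀ a → F a ≐ G a) → ⨁< B F ≐ ⨁< B G
⨁-cong B F≐G = coeffwise λ i e → ∑-cong (upTo B) λ a → at (F≐G a) i e

⨁-suc : ∀ B F → ⨁< (suc B) F ≐ ⨁< B F ⊕ F B
⨁-suc B F = coeffwise λ i e → ∑-upTo-suc B λ a → F a i e

t^-t^ : ∀ a b P → t^ a · t^ b · P ≐ t^ (a ℤ.+ b) · P
t^-t^ a b P = coeffwise λ i e → cong (P i) (lemma a b e)
  where
  lemma : ∀ a b e → e ℤ.- a ℤ.- b ≡ e ℤ.- (a ℤ.+ b)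
  lemma = solve-∀

U-comm : ∀ j k P → U j (U k P) ≐ U k (U j P)
U-comm j k P = coeffwise λ i e → trans
  (interchange ℕ.+-commutativeSemigroup (P i e) (P (i ℤ.- + 1) (e ℤ.- k)) (P (i ℤ.- + 1) (e ℤ.- j))
                                       (P (i ℤ.- + 1 ℤ.- + 1) (e ℤ.- j ℤ.- k)))
  (cong (λ e′ → P i e + P (i ℤ.- + 1) (e ℤ.- j) + (P (i ℤ.- + 1) (e ℤ.- k) + P (i ℤ.- + 1 ℤ.- + 1) e′)) (lemma e j k))
  where
  lemma : ∀ e j k → e ℤ.- j ℤ.- k ≡ e ℤ.- k ℤ.- j
  lemma = solve-∀

U-∏U-comm : ∀ j lo n P → U j (∏U lo n P) ≐ ∏U lo n (U j P)
U-∏U-comm j lo zero    P = ≐-refl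
U-∏U-comm j lo (suc n) P = ≐-trans (U-comm j (+ lo) (∏U (suc lo) n P)) (U-cong (+ lo) (U-∏U-comm j (suc lo) n P))

∏U-+ : ∀ lo m n P → ∏U lo (m + n) P ≐ ∏U lo m (∏U (lo + m) n P)
∏U-+ lo zero    n P rewrite ℕ.+-identityʳ lo = ≐-refl
∏U-+ lo (suc m) n P rewrite ℕ.+-suc lo m = U-cong (+ lo) (∏U-+ (suc lo) m n P)

∏U-suc : ∀ B P → ∏U 0 (suc B) P ≐ U (+ B) (∏U 0 B P)
∏U-suc B P = ≐-trans (≐-reflexive (cong (λ n → ∏U 0 n P) (ℕ.+-comm 1 B)))
                     (≐-trans (∏U-+ 0 B 1 P) (≐-sym (U-∏U-comm (+ B) 0 B P)))

U-⊕ : ∀ j P Q → U j (P ⊕ Q) ≐ U j P ⊕ U j Q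
U-⊕ j P Q = coeffwise λ i e → interchange ℕ.+-commutativeSemigroup (P i e) (Q i e) (P (i ℤ.- + 1) (e ℤ.- j)) (Q (i ℤ.- + 1) (e ℤ.- j))

∏U-⊕ : ∀ lo n P Q → ∏U lo n (P ⊕ Q) ≐ ∏U lo n P ⊕ ∏U lo n Q
∏U-⊕ lo zero    P Q = ≐-refl
∏U-⊕ lo (suc n) P Q = ≐-trans (U-cong (+ lo) (∏U-⊕ (suc lo) n P Q)) (U-⊕ (+ lo) (∏U (suc lo) n P) (∏U (suc lo) n Q))

U-t^-comm : ∀ j a P → U j (t^ a · P) ≐ t^ a · U j P
U-t^-comm j a P = coeffwise λ i e → cong (λ e′ → P i (e ℤ.- a) + P (i ℤ.- + 1) e′) (lemma e j a)
  where
  lemma : ∀ e j a → e ℤ.- j ℤ.- a ≡ e ℤ.- a ℤ.- j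
  lemma = solve-∀

∏U-t^-comm : ∀ lo n a P → ∏U lo n (t^ a · P) ≐ t^ a · ∏U lo n P
∏U-t^-comm lo zero    a P = ≐-refl
∏U-t^-comm lo (suc n) a P = ≐-trans (U-cong (+ lo) (∏U-t^-comm (suc lo) n a P)) (U-t^-comm (+ lo) a (∏U (suc lo) n P))

NonNegU : Series → Set
NonNegU P = ∀ n e → P -[1+ n ] e ≡ 0

𝟙-nonNegU : NonNegU 𝟙
𝟙-nonNegU n e = refl

t^-nonNegU : ∀ a P → NonNegU P → NonNegU (t^ a · P)
t^-nonNegU a P P≥0 n e = P≥0 n (e ℤ.- a)

U-nonNegU : ∀ j P → NonNegU P → NonNegU (U j P)
U-nonNegU j P P≥0 n e = cong₂ _+_ (P≥0 n e) (P≥0 (suc (n + 0)) (e ℤ.- j))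

∏U-nonNegU : ∀ lo n P → NonNegU P → NonNegU (∏U lo n P)
∏U-nonNegU lo zero    P P≥0 = P≥0
∏U-nonNegU lo (suc n) P P≥0 = U-nonNegU (+ lo) (∏U (suc lo) n P) (∏U-nonNegU (suc lo) n P P≥0)

⨁-nonNegU : ∀ B F → (∀ a → NonNegU (F a)) → NonNegU (⨁< B F)
⨁-nonNegU B F F≥0 n e = trans (∑-cong (upTo B) λ a → F≥0 a n e) (∑-zero (upTo B))

U-coeff-u⁰ : ∀ j P → NonNegU P → ∀ e → U j P (+ 0) e ≡ P (+ 0) e
U-coeff-u⁰ j P P≥0 e = trans (cong (_+_ (P (+ 0) e)) (P≥0 0 (e ℤ.- j))) (ℕ.+-identityʳ _)

∏U-coeff-u⁰ : ∀ lo n P → NonNegU P → ∀ e → ∏U lo n P (+ 0) e ≡ P (+ 0) e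
∏U-coeff-u⁰ lo zero    P P≥0 e = refl
∏U-coeff-u⁰ lo (suc n) P P≥0 e =
  trans (U-coeff-u⁰ (+ lo) (∏U (suc lo) n P) (∏U-nonNegU (suc lo) n P P≥0) e) (∏U-coeff-u⁰ (suc lo) n P P≥0 e)

∏W : ℕ → ℕ → Series → Series
∏W lo zero    P = P
∏W lo (suc n) P = W (+ lo) (∏W (suc lo) n P)

-- A run of length c starting at a contributes t^a and Π's factors for a+1, …, a+c-1;
-- the next run starts below a + c.
runs : (ℕ → ℕ → Series → Series) → ℕ → List ℕ → Series
runs Π B []      = 𝟙
runs Π B (c ∷ κ) = ⨁[ a < B ] t^ + a · Π (suc a) (c ∸ 1) (runs Π (a + c) κ)

G : ℕ → List ℕ → Series
G B κ = ∏U 0 B (runs ∏U B κ)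

runs∏U-nonNegU : ∀ B κ → NonNegU (runs ∏U B κ)
runs∏U-nonNegU B []      = 𝟙-nonNegU
runs∏U-nonNegU B (c ∷ κ) = ⨁-nonNegU B (λ a → t^ + a · ∏U (suc a) (c ∸ 1) (runs ∏U (a + c) κ)) λ a →
  t^-nonNegU (+ a) (∏U (suc a) (c ∸ 1) (runs ∏U (a + c) κ)) (∏U-nonNegU (suc a) (c ∸ 1) (runs ∏U (a + c) κ) (runs∏U-nonNegU (a + c) κ))

G-nonNegU : ∀ B κ → NonNegU (G B κ)
G-nonNegU B κ = ∏U-nonNegU 0 B (runs ∏U B κ) (runs∏U-nonNegU B κ)

G-suc-[] : ∀ B → G (suc B) [] ≐ U (+ B) (G B [])
G-suc-[] B = ∏U-suc B 𝟙

G-suc-∷ : ∀ B c κ → G (suc B) (suc c ∷ κ) ≐ U (+ B) (G B (suc c ∷ κ)) ⊕ t^ + B · G (B + suc c) κ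
G-suc-∷ B c κ = begin
  ∏U 0 (suc B) (⨁< (suc B) F)                          ≈⟨ ∏U-cong 0 (suc B) (⨁-suc B F) ⟩
  ∏U 0 (suc B) (⨁< B F ⊕ F B)                          ≈⟨ ∏U-⊕ 0 (suc B) (⨁< B F) (F B) ⟩
  ∏U 0 (suc B) (⨁< B F) ⊕ ∏U 0 (suc B) (F B)           ≈⟨ ⊕-cong (∏U-suc B (⨁< B F)) (∏U-t^-comm 0 (suc B) (+ B) _) ⟩
  U (+ B) (G B (suc c ∷ κ)) ⊕ t^ + B · ∏U 0 (suc B) (∏U (suc B) c R)
    ≈⟨ ⊕-congˡ (U (+ B) (G B (suc c ∷ κ))) (t^-cong (+ B) (≐-sym (∏U-+ 0 (suc B) c R))) ⟩
  U (+ B) (G B (suc c ∷ κ)) ⊕ t^ + B · ∏U 0 (suc B + c) R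
    ≈⟨ ⊕-congˡ (U (+ B) (G B (suc c ∷ κ))) (t^-cong (+ B) (≐-reflexive (cong (λ n → ∏U 0 n R) (sym (ℕ.+-suc B c))))) ⟩
  U (+ B) (G B (suc c ∷ κ)) ⊕ t^ + B · G (B + suc c) κ ∎
  where
  open ≐-Reasoning
  F : ℕ → Series
  F a = t^ + a · ∏U (suc a) c (runs ∏U (a + suc c) κ)
  R : Series
  R = runs ∏U (B + suc c) κ

-- The sequences of M^λ_k

−-suc-left : ∀ m l → + m ℤ.- + l ≡ + suc m ℤ.- + l ℤ.- + 1
−-suc-left m l = lemma (+ m) (+ l)
  where
  lemma : ∀ x y → x ℤ.- y ≡ (+ 1 ℤ.+ x) ℤ.- y ℤ.- + 1
  lemma = solve-∀

−-suc-both : ∀ m l → + m ℤ.- + l ≡ + suc m ℤ.- + suc l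
−-suc-both m l = lemma (+ m) (+ l)
  where
  lemma : ∀ x y → x ℤ.- y ≡ (+ 1 ℤ.+ x) ℤ.- (+ 1 ℤ.+ y)
  lemma = solve-∀

-- countM m B κ e is the number of sequences ((a₁,b₁),…,(a_m,b_m)) with a₁ < B,
-- a_{i+1} < a_i + b_i, nonzero b's forming κ in order, and a₁ + ⋯ + a_m = e.
countM : ℕ → ℕ → List ℕ → ℤ → ℕ
countM zero    B []      e = δ e (+ 0)
countM zero    B (_ ∷ _) e = 0
countM (suc m) B []      e = ∑[ a ∈ upTo B ] countM m a [] (e ℤ.- + a)
countM (suc m) B (c ∷ κ) e = ∑[ a ∈ upTo B ] (countM m a (c ∷ κ) (e ℤ.- + a) + countM m (a + c) κ (e ℤ.- + a))

countM≡G : ∀ m B κ → All (1 ≤_) κ → ∀ e → countM m B κ e ≡ G B κ (+ m ℤ.- + length κ) e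
countM≡G zero    B       []          _        e = sym (∏U-coeff-u⁰ 0 B 𝟙 𝟙-nonNegU e)
countM≡G zero    B       (c ∷ κ)     _        e = sym (G-nonNegU B (c ∷ κ) (length κ) e)
countM≡G (suc m) zero    []          _        e = refl
countM≡G (suc m) zero    (c ∷ κ)     _        e = refl
countM≡G (suc m) (suc B) []          pos      e = begin
  countM (suc m) (suc B) [] e
    ≡⟨ ∑-upTo-suc B _ ⟩
  countM (suc m) B [] e + countM m B [] (e ℤ.- + B)
    ≡⟨ cong₂ _+_ (countM≡G (suc m) B [] pos e) (countM≡G m B [] pos (e ℤ.- + B)) ⟩
  G B [] (+ suc m ℤ.- + 0) e + G B [] (+ m ℤ.- + 0) (e ℤ.- + B)
    ≡⟨ cong (λ i → G B [] (+ suc m ℤ.- + 0) e + G B [] i (e ℤ.- + B)) (−-suc-left m 0) ⟩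
  U (+ B) (G B []) (+ suc m ℤ.- + 0) e
    ≡⟨ sym (at (G-suc-[] B) (+ suc m ℤ.- + 0) e) ⟩
  G (suc B) [] (+ suc m ℤ.- + 0) e ∎
  where open ≡-Reasoning
countM≡G (suc m) (suc B) (suc c ∷ κ) (p ∷ pos) e = begin
  countM (suc m) (suc B) κ′ e
    ≡⟨ ∑-upTo-suc B _ ⟩
  countM (suc m) B κ′ e + (countM m B κ′ (e ℤ.- + B) + countM m (B + suc c) κ (e ℤ.- + B))
    ≡⟨ cong₂ _+_ (countM≡G (suc m) B κ′ (p ∷ pos) e)
                 (cong₂ _+_ (countM≡G m B κ′ (p ∷ pos) (e ℤ.- + B)) (countM≡G m (B + suc c) κ pos (e ℤ.- + B))) ⟩
  G B κ′ i e + (G B κ′ (+ m ℤ.- + ℓ′) (e ℤ.- + B) + G (B + suc c) κ (+ m ℤ.- + ℓ) (e ℤ.- + B))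
    ≡⟨ cong₂ (λ i′ i″ → G B κ′ i e + (G B κ′ i′ (e ℤ.- + B) + G (B + suc c) κ i″ (e ℤ.- + B)))
             (−-suc-left m ℓ′) (−-suc-both m ℓ) ⟩
  G B κ′ i e + (G B κ′ (i ℤ.- + 1) (e ℤ.- + B) + G (B + suc c) κ i (e ℤ.- + B))
    ≡⟨ sym (ℕ.+-assoc (G B κ′ i e) _ _) ⟩
  (U (+ B) (G B κ′) ⊕ t^ + B · G (B + suc c) κ) i e
    ≡⟨ sym (at (G-suc-∷ B c κ) i e) ⟩
  G (suc B) κ′ i e ∎
  where
  open ≡-Reasoning
  κ′ = suc c ∷ κ
  ℓ = length κ
  ℓ′ = suc ℓ
  i = + suc m ℤ.- + ℓ′

δ-sym : ∀ x y → δ x y ≡ δ y x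
δ-sym x y = cong (λ b → [ b ]· 1) (⌊⌋-⇔ (x ℤ.≟ y) (y ℤ.≟ x) sym sym)

≟-shift : ∀ a r e → ⌊ a ℤ.+ r ℤ.≟ e ⌋ ≡ ⌊ r ℤ.≟ e ℤ.- a ⌋
≟-shift a r e = ⌊⌋-⇔ (a ℤ.+ r ℤ.≟ e) (r ℤ.≟ e ℤ.- a)
  (λ { refl → sym (cancel a r) }) (λ { refl → uncancel a e })
  where
  cancel : ∀ x y → x ℤ.+ y ℤ.- x ≡ y
  cancel = solve-∀
  uncancel : ∀ x y → x ℤ.+ (y ℤ.- x) ≡ y
  uncancel = solve-∀

δ-shift : ∀ a r e → δ (a ℤ.+ r) e ≡ δ r (e ℤ.- a)
δ-shift a r e = cong (λ b → [ b ]· 1) (≟-shift a r e)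

aSeqCount : ℕ → List ℕ → ℤ → ℕ
aSeqCount a bs e = ∑[ as ∈ aSeqs a bs ] δ (+ ρ (zipPairs as bs)) e

startBelowCount : ℕ → List ℕ → ℤ → ℕ
startBelowCount B []       e = δ e (+ 0)
startBelowCount B (b ∷ bs) e = ∑[ a ∈ upTo B ] aSeqCount a (b ∷ bs) e

aSeqCount-∷ : ∀ a b bs e → aSeqCount a (b ∷ bs) e ≡ startBelowCount (a + b) bs (e ℤ.- + a)
aSeqCount-∷ a b []        e = trans (ℕ.+-identityʳ _) (trans (δ-shift (+ a) (+ 0) e) (δ-sym (+ 0) (e ℤ.- + a)))
aSeqCount-∷ a b (b′ ∷ bs) e =
  trans (∑-concatMap (λ a′ → map (a ∷_) (aSeqs a′ (b′ ∷ bs))) (upTo (a + b)) _)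
        (∑-cong (upTo (a + b)) λ a′ → trans (∑-map (a ∷_) (aSeqs a′ (b′ ∷ bs)) _)
          (∑-cong (aSeqs a′ (b′ ∷ bs)) λ as → δ-shift (+ a) (+ ρ (zipPairs as (b′ ∷ bs))) e))

∑-upTo-select : ∀ N d (h : ℕ → ℕ) → d < N → ∑[ y ∈ upTo N ] [ ⌊ y ℕ.≟ d ⌋ ]· h y ≡ h d
∑-upTo-select (suc N) d h d<1+N with ℕ.m≤n⇒m<n∨m≡n (ℕ.≤-pred d<1+N)
... | inj₁ d<N = begin
  ∑[ y ∈ upTo (suc N) ] [ ⌊ y ℕ.≟ d ⌋ ]· h y    ≡⟨ ∑-upTo-suc N _ ⟩
  _ + [ ⌊ N ℕ.≟ d ⌋ ]· h N                      ≡⟨ cong₂ _+_ (∑-upTo-select N d h d<N)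
                                                             (cong (λ b → [ b ]· h N) (⌊⌋-false (N ℕ.≟ d) (ℕ.>⇒≢ d<N))) ⟩
  h d + 0                                       ≡⟨ ℕ.+-identityʳ (h d) ⟩
  h d                                           ∎
  where open ≡-Reasoning
... | inj₂ refl = begin
  ∑[ y ∈ upTo (suc N) ] [ ⌊ y ℕ.≟ N ⌋ ]· h y    ≡⟨ ∑-upTo-suc N _ ⟩
  _ + [ ⌊ N ℕ.≟ N ⌋ ]· h N                      ≡⟨ cong₂ _+_ earlier (cong (λ b → [ b ]· h N) (⌊⌋-true (N ℕ.≟ N) refl)) ⟩
  h N                                           ∎
  where
  open ≡-Reasoning
  earlier : ∑[ y ∈ upTo N ] [ ⌊ y ℕ.≟ N ⌋ ]· h y ≡ 0
  earlier = trans (∑-cong-All (All.all-upTo N) λ {y} y<N → cong (λ b → [ b ]· h y) (⌊⌋-false (y ℕ.≟ N) (ℕ.<⇒≢ y<N)))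
                  (∑-zero (upTo N))

nonzeros : List ℕ → List ℕ
nonzeros []           = []
nonzeros (zero  ∷ xs) = nonzeros xs
nonzeros (suc x ∷ xs) = suc x ∷ nonzeros xs

infix 4 _≡ᵇ_

_≡ᵇ_ : List ℕ → List ℕ → Bool
xs ≡ᵇ ys = ⌊ List.≡-dec ℕ._≟_ xs ys ⌋

≡ᵇ-∷ : ∀ x y xs ys → (x ∷ xs ≡ᵇ y ∷ ys) ≡ ⌊ x ℕ.≟ y ⌋ ∧ (xs ≡ᵇ ys)
≡ᵇ-∷ x y xs ys with x ℕ.≟ y | List.≡-dec ℕ._≟_ xs ys
... | yes _ | yes _ = refl
... | yes _ | no  _ = refl
... | no  _ | yes _ = refl
... | no  _ | no  _ = refl

≟-suc : ∀ x y → ⌊ suc x ℕ.≟ suc y ⌋ ≡ ⌊ x ℕ.≟ y ⌋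
≟-suc x y = ⌊⌋-⇔ (suc x ℕ.≟ suc y) (x ℕ.≟ y) ℕ.suc-injective (cong suc)

∑-startBelowCount-∷ : ∀ (L : List (List ℕ)) (X : List ℕ → Bool) B b e →
  ∑[ bs ∈ L ] [ X bs ]· startBelowCount B (b ∷ bs) e ≡
  ∑[ a ∈ upTo B ] ∑[ bs ∈ L ] [ X bs ]· startBelowCount (a + b) bs (e ℤ.- + a)
∑-startBelowCount-∷ L X B b e = begin
  ∑[ bs ∈ L ] [ X bs ]· startBelowCount B (b ∷ bs) e
    ≡⟨ ∑-cong L (λ bs → cong [ X bs ]·_ (∑-cong (upTo B) λ a → aSeqCount-∷ a b bs e)) ⟩
  ∑[ bs ∈ L ] [ X bs ]· ∑[ a ∈ upTo B ] startBelowCount (a + b) bs (e ℤ.- + a)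
    ≡⟨ ∑-cong L (λ bs → sym (∑-[]· (X bs) (upTo B) _)) ⟩
  ∑[ bs ∈ L ] ∑[ a ∈ upTo B ] [ X bs ]· startBelowCount (a + b) bs (e ℤ.- + a)
    ≡⟨ ∑-comm L (upTo B) _ ⟩
  ∑[ a ∈ upTo B ] ∑[ bs ∈ L ] [ X bs ]· startBelowCount (a + b) bs (e ℤ.- + a) ∎
  where open ≡-Reasoning

∑-nonzeros≡countM : ∀ m N B κ → All (1 ≤_) κ → All (_≤ N) κ → ∀ e →
  ∑[ bs ∈ allLists m N ] [ nonzeros bs ≡ᵇ κ ]· startBelowCount B bs e ≡ countM m B κ e
∑-nonzeros≡countM zero    N B []      pos bnd e = ℕ.+-identityʳ _
∑-nonzeros≡countM zero    N B (c ∷ κ) pos bnd e = refl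
∑-nonzeros≡countM (suc m) N B κ       pos bnd e = begin
  ∑ (concatMap (λ x → map (x ∷_) L) (upTo (suc N))) f
    ≡⟨ ∑-concatMap (λ x → map (x ∷_) L) (upTo (suc N)) f ⟩
  ∑ (map (0 ∷_) L) f + ∑[ x ∈ applyUpTo suc N ] ∑ (map (x ∷_) L) f
    ≡⟨ cong₂ _+_ (∑-map (0 ∷_) L f) (trans (∑-applyUpTo-suc N _) (∑-cong (upTo N) λ y → ∑-map (suc y ∷_) L f)) ⟩
  ∑[ bs ∈ L ] f (0 ∷ bs) + ∑[ y ∈ upTo N ] ∑[ bs ∈ L ] f (suc y ∷ bs)
    ≡⟨ cong₂ _+_ firstZero (firstNonzero κ pos bnd) ⟩
  ∑[ a ∈ upTo B ] countM m a κ (e ℤ.- + a) + rest κ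
    ≡⟨ combine κ ⟩
  countM (suc m) B κ e ∎
  where
  open ≡-Reasoning
  L = allLists m N
  f : List ℕ → ℕ
  f bs = [ nonzeros bs ≡ᵇ κ ]· startBelowCount B bs e

  firstZero : ∑[ bs ∈ L ] f (0 ∷ bs) ≡ ∑[ a ∈ upTo B ] countM m a κ (e ℤ.- + a)
  firstZero = trans (∑-startBelowCount-∷ L (λ bs → nonzeros bs ≡ᵇ κ) B 0 e)
    (∑-cong (upTo B) λ a → trans (∑-nonzeros≡countM m N (a + 0) κ pos bnd (e ℤ.- + a))
                                 (cong (λ B′ → countM m B′ κ (e ℤ.- + a)) (ℕ.+-identityʳ a)))

  rest : List ℕ → ℕ
  rest []      = 0
  rest (c ∷ κ′) = ∑[ a ∈ upTo B ] countM m (a + c) κ′ (e ℤ.- + a)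

  firstNonzero : ∀ κ → All (1 ≤_) κ → All (_≤ N) κ →
    ∑[ y ∈ upTo N ] ∑[ bs ∈ L ] [ nonzeros (suc y ∷ bs) ≡ᵇ κ ]· startBelowCount B (suc y ∷ bs) e ≡ rest κ
  firstNonzero [] _ _ = trans (∑-cong (upTo N) λ y → ∑-zero L) (∑-zero (upTo N))
  firstNonzero (suc c ∷ κ′) (_ ∷ pos′) (c<N ∷ bnd′) = begin
    ∑[ y ∈ upTo N ] ∑[ bs ∈ L ] [ nonzeros (suc y ∷ bs) ≡ᵇ suc c ∷ κ′ ]· startBelowCount B (suc y ∷ bs) e
      ≡⟨ ∑-cong (upTo N) (λ y → trans (∑-cong L λ bs → headMatch y bs) (∑-[]· ⌊ y ℕ.≟ c ⌋ L _)) ⟩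
    ∑[ y ∈ upTo N ] [ ⌊ y ℕ.≟ c ⌋ ]· ∑[ bs ∈ L ] [ nonzeros bs ≡ᵇ κ′ ]· startBelowCount B (suc y ∷ bs) e
      ≡⟨ ∑-upTo-select N c _ c<N ⟩
    ∑[ bs ∈ L ] [ nonzeros bs ≡ᵇ κ′ ]· startBelowCount B (suc c ∷ bs) e
      ≡⟨ ∑-startBelowCount-∷ L (λ bs → nonzeros bs ≡ᵇ κ′) B (suc c) e ⟩
    ∑[ a ∈ upTo B ] ∑[ bs ∈ L ] [ nonzeros bs ≡ᵇ κ′ ]· startBelowCount (a + suc c) bs (e ℤ.- + a)
      ≡⟨ ∑-cong (upTo B) (λ a → ∑-nonzeros≡countM m N (a + suc c) κ′ pos′ bnd′ (e ℤ.- + a)) ⟩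
    rest (suc c ∷ κ′) ∎
    where
    headMatch : ∀ y bs → [ nonzeros (suc y ∷ bs) ≡ᵇ suc c ∷ κ′ ]· startBelowCount B (suc y ∷ bs) e
                       ≡ [ ⌊ y ℕ.≟ c ⌋ ]· [ nonzeros bs ≡ᵇ κ′ ]· startBelowCount B (suc y ∷ bs) e
    headMatch y bs = trans (cong (λ b → [ b ]· startBelowCount B (suc y ∷ bs) e)
                                 (trans (≡ᵇ-∷ (suc y) (suc c) (nonzeros bs) κ′) (cong (_∧ _) (≟-suc y c))))
                           ([]·-∧ ⌊ y ℕ.≟ c ⌋ _ _)

  combine : ∀ κ → ∑[ a ∈ upTo B ] countM m a κ (e ℤ.- + a) + rest κ ≡ countM (suc m) B κ e
  combine []      = ℕ.+-identityʳ _
  combine (c ∷ κ′) = sym (∑-+ (upTo B) _ _)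

-- Reversing the power of u

-- reverseU D P is u^D · P(1/u, t).
reverseU : ℤ → Series → Series
reverseU D P i e = P (D ℤ.- i) e

reverseU-index : ∀ {D D′} P → D ≡ D′ → reverseU D P ≐ reverseU D′ P
reverseU-index P refl = ≐-refl

reverseU-𝟙 : reverseU (+ 0) 𝟙 ≐ 𝟙
reverseU-𝟙 = coeffwise λ i e → cong (λ b → [ b ]· δ e (+ 0))
  (⌊⌋-⇔ (+ 0 ℤ.- i ℤ.≟ + 0) (i ℤ.≟ + 0) (λ p → trans (sym (negate-negate i)) (cong ℤ.-_ p)) λ { refl → refl })
  where
  negate-negate : ∀ x → ℤ.- (+ 0 ℤ.- x) ≡ x
  negate-negate = solve-∀

reverseU-W : ∀ D j P → reverseU D (W j P) ≐ U j (reverseU (D ℤ.- + 1) P)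
reverseU-W D j P = coeffwise λ i e → trans (ℕ.+-comm (P (D ℤ.- i) (e ℤ.- j)) (P (D ℤ.- i ℤ.- + 1) e))
  (cong₂ _+_ (cong (λ i′ → P i′ e) (lemma₁ D i)) (cong (λ i′ → P i′ (e ℤ.- j)) (lemma₂ D i)))
  where
  lemma₁ : ∀ D i → D ℤ.- i ℤ.- + 1 ≡ D ℤ.- + 1 ℤ.- i
  lemma₁ = solve-∀
  lemma₂ : ∀ D i → D ℤ.- i ≡ D ℤ.- + 1 ℤ.- (i ℤ.- + 1)
  lemma₂ = solve-∀

reverseU-∏W : ∀ D lo n P → reverseU D (∏W lo n P) ≐ ∏U lo n (reverseU (D ℤ.- + n) P)
reverseU-∏W D lo zero    P = reverseU-index P (lemma D)
  where
  lemma : ∀ D → D ≡ D ℤ.- + 0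
  lemma = solve-∀
reverseU-∏W D lo (suc n) P = ≐-trans (reverseU-W D (+ lo) (∏W (suc lo) n P))
  (U-cong (+ lo) (≐-trans (reverseU-∏W (D ℤ.- + 1) (suc lo) n P) (∏U-cong (suc lo) n (reverseU-index P (lemma D (+ n))))))
  where
  lemma : ∀ D n → D ℤ.- + 1 ℤ.- n ≡ D ℤ.- (+ 1 ℤ.+ n)
  lemma = solve-∀

-- The u-degree of runs ∏W B κ: a run of length c contributes c - 1 factors (t^i + u).
runsExcess : List ℕ → ℤ
runsExcess []      = + 0
runsExcess (c ∷ κ) = + (c ∸ 1) ℤ.+ runsExcess κ

runs∏U≐reverseU-runs∏W : ∀ B κ → runs ∏U B κ ≐ reverseU (runsExcess κ) (runs ∏W B κ)
runs∏U≐reverseU-runs∏W B []      = ≐-sym reverseU-𝟙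
runs∏U≐reverseU-runs∏W B (c ∷ κ) = ⨁-cong B λ a → t^-cong (+ a) (begin
  ∏U (suc a) (c ∸ 1) (runs ∏U (a + c) κ)
    ≈⟨ ∏U-cong (suc a) (c ∸ 1) (runs∏U≐reverseU-runs∏W (a + c) κ) ⟩
  ∏U (suc a) (c ∸ 1) (reverseU (runsExcess κ) (runs ∏W (a + c) κ))
    ≈⟨ ∏U-cong (suc a) (c ∸ 1) (reverseU-index (runs ∏W (a + c) κ) (sym (lemma (+ (c ∸ 1)) (runsExcess κ)))) ⟩
  ∏U (suc a) (c ∸ 1) (reverseU (runsExcess (c ∷ κ) ℤ.- + (c ∸ 1)) (runs ∏W (a + c) κ))
    ≈⟨ ≐-sym (reverseU-∏W (runsExcess (c ∷ κ)) (suc a) (c ∸ 1) (runs ∏W (a + c) κ)) ⟩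
  reverseU (runsExcess (c ∷ κ)) (∏W (suc a) (c ∸ 1) (runs ∏W (a + c) κ)) ∎)
  where
  open ≐-Reasoning
  lemma : ∀ x y → x ℤ.+ y ℤ.- x ≡ y
  lemma = solve-∀

G-1≐reverseU : ∀ κ → G 1 κ ≐ reverseU (runsExcess κ ℤ.+ + 1) (W (+ 0) (runs ∏W 1 κ))
G-1≐reverseU κ = ≐-trans
  (U-cong (+ 0) (≐-trans (runs∏U≐reverseU-runs∏W 1 κ) (reverseU-index (runs ∏W 1 κ) (lemma (runsExcess κ)))))
  (≐-sym (reverseU-W (runsExcess κ ℤ.+ + 1) (+ 0) (runs ∏W 1 κ)))
  where
  lemma : ∀ d → d ≡ d ℤ.+ + 1 ℤ.- + 1
  lemma = solve-∀

-- Dyck paths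

monomial : ℕ × ℤ → Series
monomial (a , b) i e = [ ⌊ + a ℤ.≟ i ⌋ ]· δ b e

⟦_⟧ : BPoly → Series
⟦ p ⟧ i e = ∑[ m ∈ p ] monomial m i e

monomial-shift : ∀ a a′ b b′ i e → monomial (a + a′ , b ℤ.+ b′) i e ≡ monomial (a′ , b′) (i ℤ.- + a) (e ℤ.- b)
monomial-shift a a′ b b′ i e = cong₂ [_]·_ (≟-shift (+ a) (+ a′) i) (δ-shift b b′ e)

⟦*B⟧ : ∀ p q i e → ⟦ p *B q ⟧ i e ≡ ∑[ m ∈ p ] ⟦ q ⟧ (i ℤ.- + proj₁ m) (e ℤ.- proj₂ m)
⟦*B⟧ p q i e = trans (∑-concatMap _ p _) (∑-cong p λ m → trans (∑-map _ q _)
  (∑-cong q λ m′ → monomial-shift (proj₁ m) (proj₁ m′) (proj₂ m) (proj₂ m′) i e))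

−-zero : ∀ x → x ℤ.- + 0 ≡ x
−-zero = solve-∀

⟦oneB⟧ : ⟦ oneB ⟧ ≐ 𝟙
⟦oneB⟧ = coeffwise λ i e → trans (ℕ.+-identityʳ _)
  (cong₂ [_]·_ (⌊⌋-⇔ (+ 0 ℤ.≟ i) (i ℤ.≟ + 0) sym sym) (δ-sym (+ 0) e))

⟦oneB*B⟧ : ∀ q → ⟦ oneB *B q ⟧ ≐ ⟦ q ⟧
⟦oneB*B⟧ q = coeffwise λ i e → trans (⟦*B⟧ oneB q i e) (trans (ℕ.+-identityʳ _) (cong₂ ⟦ q ⟧ (−-zero i) (−-zero e)))

binomial : ℤ → BPoly
binomial x = (0 , + 0) ∷ (1 , x) ∷ []

⟦binomial*B⟧ : ∀ x q → ⟦ binomial x *B q ⟧ ≐ U x ⟦ q ⟧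
⟦binomial*B⟧ x q = coeffwise λ i e → trans (⟦*B⟧ (binomial x) q i e)
  (cong₂ _+_ (cong₂ ⟦ q ⟧ (−-zero i) (−-zero e)) (ℕ.+-identityʳ _))

⟦prodFactors-∷∷⟧ : ∀ x y αs → ⟦ prodFactors (x ∷ y ∷ αs) ⟧ ≐
  (if ⌊ y ℕ.≟ suc x ⌋ then U (ℤ.- (+ y)) ⟦ prodFactors (y ∷ αs) ⟧ else ⟦ prodFactors (y ∷ αs) ⟧)
⟦prodFactors-∷∷⟧ x y αs with ⌊ y ℕ.≟ suc x ⌋
... | true  = ⟦binomial*B⟧ (ℤ.- (+ y)) (prodFactors (y ∷ αs))
... | false = ⟦oneB*B⟧ (prodFactors (y ∷ αs))

-- The factor of a row with area y following a row with area p in t^area · ∏ (1 + u t^(-αᵢ)).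
rowFactor : ℕ → ℕ → Series → Series
rowFactor p y P = if ⌊ y ℕ.≟ suc p ⌋ then W (+ y) P else t^ + y · P

rowProduct : ℕ → List ℕ → Series
rowProduct p []       = 𝟙
rowProduct p (y ∷ αs) = rowFactor p y (rowProduct y αs)

t^-U-⁻¹ : ∀ y s P → t^ (+ y ℤ.+ + s) · U (ℤ.- (+ y)) P ≐ W (+ y) (t^ + s · P)
t^-U-⁻¹ y s P = coeffwise λ i e → cong₂ _+_ (cong (P i) (lemma₁ (+ y) (+ s) e)) (cong (P (i ℤ.- + 1)) (lemma₂ (+ y) (+ s) e))
  where
  lemma₁ : ∀ y s e → e ℤ.- (y ℤ.+ s) ≡ e ℤ.- y ℤ.- s
  lemma₁ = solve-∀
  lemma₂ : ∀ y s e → e ℤ.- (y ℤ.+ s) ℤ.- ℤ.- y ≡ e ℤ.- s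
  lemma₂ = solve-∀

t^sum-⟦prodFactors⟧ : ∀ p αs → t^ + sum αs · ⟦ prodFactors (p ∷ αs) ⟧ ≐ rowProduct p αs
t^sum-⟦prodFactors⟧ p []       = coeffwise λ i e → trans (cong (⟦ prodFactors (p ∷ []) ⟧ i) (−-zero e)) (at ⟦oneB⟧ i e)
t^sum-⟦prodFactors⟧ p (y ∷ αs) with ⌊ y ℕ.≟ suc p ⌋ | ⟦prodFactors-∷∷⟧ p y αs
... | true  | eq = ≐-trans (t^-cong (+ (y + sum αs)) eq)
                  (≐-trans (t^-U-⁻¹ y (sum αs) ⟦ prodFactors (y ∷ αs) ⟧) (W-cong (+ y) (t^sum-⟦prodFactors⟧ y αs)))
... | false | eq = ≐-trans (t^-cong (+ (y + sum αs)) eq)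
                  (≐-trans (≐-sym (t^-t^ (+ y) (+ sum αs) ⟦ prodFactors (y ∷ αs) ⟧)) (t^-cong (+ y) (t^sum-⟦prodFactors⟧ y αs)))

≤?-suc : ∀ x y → ⌊ suc x ℕ.≤? suc y ⌋ ≡ ⌊ x ℕ.≤? y ⌋
≤?-suc x y = ⌊⌋-⇔ (suc x ℕ.≤? suc y) (x ℕ.≤? y) ℕ.≤-pred s≤s

weaklyAbove-suc : ∀ u r w → weaklyAbove (suc u) (suc r) w ≡ weaklyAbove u r w
weaklyAbove-suc u r []          = ≟-suc u r
weaklyAbove-suc u r (true ∷ w)  = weaklyAbove-suc (suc u) r w
weaklyAbove-suc u r (false ∷ w) = cong₂ _∧_ (≤?-suc (suc r) u) (weaklyAbove-suc u (suc r) w)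

areaSeqFrom-suc : ∀ u r w → areaSeqFrom (suc u) (suc r) w ≡ areaSeqFrom u r w
areaSeqFrom-suc u r []          = refl
areaSeqFrom-suc u r (true ∷ w)  = cong ((u ∸ r) ∷_) (areaSeqFrom-suc (suc u) r w)
areaSeqFrom-suc u r (false ∷ w) = areaSeqFrom-suc u (suc r) w

vRunsFrom-N : ∀ c w → vRunsFrom c (true ∷ w) ≡ vRunsFrom (suc c) w
vRunsFrom-N zero    w = refl
vRunsFrom-N (suc c) w = refl

infixr 10 [_]·ₛ_

[_]·ₛ_ : Bool → Series → Series
([ b ]·ₛ P) i e = [ b ]· P i e

-- pathSum m d c p κ sums rowProduct p over the words of length m that end on the diagonal, starting at
-- height d above it, inside a vertical run of which c steps are already taken, with the runs forming κ.
pathSum : ℕ → ℕ → ℕ → ℕ → List ℕ → Series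
pathSum m d c p κ i e =
  ∑[ w ∈ allWords m ] [ weaklyAbove d 0 w ]· [ vRunsFrom c w ≡ᵇ κ ]· rowProduct p (areaSeqFrom d 0 w) i e

pathSumAfterE : ℕ → ℕ → ℕ → ℕ → List ℕ → Series
pathSumAfterE m zero    c       p κ        = 𝟘
pathSumAfterE m (suc d) zero    p κ        = pathSum m d 0 p κ
pathSumAfterE m (suc d) (suc c) p []       = 𝟘
pathSumAfterE m (suc d) (suc c) p (c₀ ∷ κ) = [ ⌊ suc c ℕ.≟ c₀ ⌋ ]·ₛ pathSum m d 0 p κ

rowFactor-∑ : ∀ p y {X : Set} (L : List X) (A B : X → Bool) (P : X → Series) →
  rowFactor p y (λ i e → ∑[ w ∈ L ] [ A w ]· [ B w ]· P w i e) ≐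
  (λ i e → ∑[ w ∈ L ] [ A w ]· [ B w ]· rowFactor p y (P w) i e)
rowFactor-∑ p y L A B P with ⌊ y ℕ.≟ suc p ⌋
... | true  = coeffwise λ i e → trans (sym (∑-+ L _ _))
  (∑-cong L λ w → trans (sym ([]·-+ (A w) _ _)) (cong [ A w ]·_ (sym ([]·-+ (B w) _ _))))
... | false = ≐-refl

∑-E∷≡pathSumAfterE : ∀ m d c p κ i e →
  ∑[ w ∈ allWords m ] [ weaklyAbove d 0 (false ∷ w) ]· [ vRunsFrom c (false ∷ w) ≡ᵇ κ ]· rowProduct p (areaSeqFrom d 0 (false ∷ w)) i e
  ≡ pathSumAfterE m d c p κ i e
∑-E∷≡pathSumAfterE m zero    c       p κ        i e = ∑-zero (allWords m)
∑-E∷≡pathSumAfterE m (suc d) zero    p κ        i e = ∑-cong (allWords m) λ w →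
  cong₂ (λ b αs → [ b ]· [ vRunsFrom 0 w ≡ᵇ κ ]· rowProduct p αs i e) (weaklyAbove-suc d 0 w) (areaSeqFrom-suc d 0 w)
∑-E∷≡pathSumAfterE m (suc d) (suc c) p []       i e =
  trans (∑-cong (allWords m) λ w → []·-zero (weaklyAbove (suc d) 1 w)) (∑-zero (allWords m))
∑-E∷≡pathSumAfterE m (suc d) (suc c) p (c₀ ∷ κ) i e = trans (∑-cong (allWords m) λ w → begin
    [ weaklyAbove (suc d) 1 w ]· [ suc c ∷ vRunsFrom 0 w ≡ᵇ c₀ ∷ κ ]· rowProduct p (areaSeqFrom (suc d) 1 w) i e
      ≡⟨ cong₂ (λ b αs → [ b ]· [ suc c ∷ vRunsFrom 0 w ≡ᵇ c₀ ∷ κ ]· rowProduct p αs i e)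
               (weaklyAbove-suc d 0 w) (areaSeqFrom-suc d 0 w) ⟩
    [ weaklyAbove d 0 w ]· [ suc c ∷ vRunsFrom 0 w ≡ᵇ c₀ ∷ κ ]· rowProduct p (areaSeqFrom d 0 w) i e
      ≡⟨ cong (λ b → [ weaklyAbove d 0 w ]· [ b ]· rowProduct p (areaSeqFrom d 0 w) i e) (≡ᵇ-∷ (suc c) c₀ (vRunsFrom 0 w) κ) ⟩
    [ weaklyAbove d 0 w ]· [ ⌊ suc c ℕ.≟ c₀ ⌋ ∧ (vRunsFrom 0 w ≡ᵇ κ) ]· rowProduct p (areaSeqFrom d 0 w) i e
      ≡⟨ cong [ weaklyAbove d 0 w ]·_ ([]·-∧ ⌊ suc c ℕ.≟ c₀ ⌋ _ _) ⟩
    [ weaklyAbove d 0 w ]· [ ⌊ suc c ℕ.≟ c₀ ⌋ ]· [ vRunsFrom 0 w ≡ᵇ κ ]· rowProduct p (areaSeqFrom d 0 w) i e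
      ≡⟨ []·-comm (weaklyAbove d 0 w) ⌊ suc c ℕ.≟ c₀ ⌋ _ ⟩
    [ ⌊ suc c ℕ.≟ c₀ ⌋ ]· [ weaklyAbove d 0 w ]· [ vRunsFrom 0 w ≡ᵇ κ ]· rowProduct p (areaSeqFrom d 0 w) i e ∎)
  (∑-[]· ⌊ suc c ℕ.≟ c₀ ⌋ (allWords m) _)
  where open ≡-Reasoning

pathSum-suc : ∀ m d c p κ → pathSum (suc m) d c p κ ≐ rowFactor p d (pathSum m (suc d) (suc c) d κ) ⊕ pathSumAfterE m d c p κ
pathSum-suc m d c p κ = coeffwise λ i e → begin
  ∑ (concatMap (λ w → (true ∷ w) ∷ (false ∷ w) ∷ []) (allWords m)) (F i e)
    ≡⟨ ∑-concatMap _ (allWords m) (F i e) ⟩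
  ∑[ w ∈ allWords m ] (F i e (true ∷ w) + (F i e (false ∷ w) + 0))
    ≡⟨ ∑-cong (allWords m) (λ w → cong (_+_ (F i e (true ∷ w))) (ℕ.+-identityʳ _)) ⟩
  ∑[ w ∈ allWords m ] (F i e (true ∷ w) + F i e (false ∷ w))
    ≡⟨ ∑-+ (allWords m) _ _ ⟩
  ∑[ w ∈ allWords m ] F i e (true ∷ w) + ∑[ w ∈ allWords m ] F i e (false ∷ w)
    ≡⟨ cong₂ _+_ (afterN i e) (∑-E∷≡pathSumAfterE m d c p κ i e) ⟩
  rowFactor p d (pathSum m (suc d) (suc c) d κ) i e + pathSumAfterE m d c p κ i e ∎
  where
  open ≡-Reasoning
  F : ℤ → ℤ → List Bool → ℕ
  F i e w = [ weaklyAbove d 0 w ]· [ vRunsFrom c w ≡ᵇ κ ]· rowProduct p (areaSeqFrom d 0 w) i e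

  afterN : ∀ i e → ∑[ w ∈ allWords m ] F i e (true ∷ w) ≡ rowFactor p d (pathSum m (suc d) (suc c) d κ) i e
  afterN i e = trans
    (∑-cong (allWords m) λ w → cong (λ κ′ → [ weaklyAbove (suc d) 0 w ]· [ κ′ ≡ᵇ κ ]· rowProduct p (areaSeqFrom d 0 (true ∷ w)) i e)
                                    (vRunsFrom-N c w))
    (sym (at (rowFactor-∑ p d (allWords m) (λ w → weaklyAbove (suc d) 0 w) (λ w → vRunsFrom (suc c) w ≡ᵇ κ)
                                (λ w → rowProduct d (areaSeqFrom (suc d) 0 w))) i e))

rowFactor-≤ : ∀ p d X → d ≤ p → rowFactor p d X ≐ t^ + d · X
rowFactor-≤ p d X d≤p rewrite ⌊⌋-false (d ℕ.≟ suc p) (ℕ.<⇒≢ (s≤s d≤p)) = ≐-refl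

rowFactor-suc : ∀ p X → rowFactor p (suc p) X ≐ W (+ suc p) X
rowFactor-suc p X rewrite ⌊⌋-true (suc p ℕ.≟ suc p) refl = ≐-refl

-- remaining c c₀ is the number of steps still to come in a run of length c₀ of which c + 1 are taken.
remaining : ℕ → ℕ → Maybe ℕ
remaining zero    zero     = nothing
remaining zero    (suc c₀) = just c₀
remaining (suc c) zero     = nothing
remaining (suc c) (suc c₀) = remaining c c₀

decrement : Maybe ℕ → Maybe ℕ
decrement (just (suc r)) = just r
decrement _              = nothing

isJustZero : Maybe ℕ → Bool
isJustZero (just zero) = true
isJustZero _           = false

remaining-suc : ∀ c c₀ → remaining (suc c) c₀ ≡ decrement (remaining c c₀)
remaining-suc zero    zero           = refl
remaining-suc zero    (suc zero)     = refl
remaining-suc zero    (suc (suc c₀)) = refl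
remaining-suc (suc c) zero           = refl
remaining-suc (suc c) (suc c₀)       = remaining-suc c c₀

≟-remaining : ∀ c c₀ → ⌊ suc c ℕ.≟ c₀ ⌋ ≡ isJustZero (remaining c c₀)
≟-remaining zero    zero           = refl
≟-remaining zero    (suc zero)     = refl
≟-remaining zero    (suc (suc c₀)) = refl
≟-remaining (suc c) zero           = refl
≟-remaining (suc c) (suc c₀)       = trans (≟-suc (suc c) c₀) (≟-remaining c c₀)

-- Closed forms of pathSum: at a corner (no run in progress) at height d,
cornerForm : ℕ → ℕ → List ℕ → Series
cornerForm m d κ = [ ⌊ m ℕ.≟ sum κ + sum κ + d ⌋ ]·ₛ runs ∏W (suc d) κ

cornerFormAfterE : ℕ → ℕ → List ℕ → Series
cornerFormAfterE m zero    κ = 𝟘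
cornerFormAfterE m (suc d) κ = cornerForm m d κ

-- and inside a run whose last row has area p, with q steps of it still to come.
runFormFrom : ℕ → ℕ → Maybe ℕ → List ℕ → Series
runFormFrom m p nothing  κ = 𝟘
runFormFrom m p (just q) κ = [ ⌊ m ℕ.≟ (q + sum κ) + (q + sum κ) + suc p ⌋ ]·ₛ ∏W (suc p) q (runs ∏W (suc p + q) κ)

runForm : ℕ → ℕ → ℕ → List ℕ → Series
runForm m p c []       = 𝟘
runForm m p c (c₀ ∷ κ) = runFormFrom m p (remaining c c₀) κ

runFormAfterE : ℕ → ℕ → ℕ → List ℕ → Series
runFormAfterE m p c []       = 𝟘
runFormAfterE m p c (c₀ ∷ κ) = [ ⌊ suc c ℕ.≟ c₀ ⌋ ]·ₛ cornerForm m p κ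

runFormFrom-zero : ∀ p r κ → runFormFrom 0 p r κ ≐ 𝟘
runFormFrom-zero p nothing  κ = ≐-refl
runFormFrom-zero p (just q) κ = coeffwise λ i e → cong (λ b → [ b ]· ∏W (suc p) q (runs ∏W (suc p + q) κ) i e)
  (⌊⌋-false (0 ℕ.≟ (q + sum κ) + (q + sum κ) + suc p) λ eq → ℕ.0≢1+n (trans eq (ℕ.+-suc _ p)))

+-suc-middle : ∀ A d → A + suc A + d ≡ A + A + suc d
+-suc-middle A d = trans (cong (_+ d) (ℕ.+-suc A A)) (sym (ℕ.+-suc (A + A) d))

[]·-+-comm : ∀ b x y → [ b ]· x + [ b ]· y ≡ [ b ]· (y + x)
[]·-+-comm b x y = trans (sym ([]·-+ b x y)) (cong [ b ]·_ (ℕ.+-comm x y))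

cornerForm-suc : ∀ m d κ → All (1 ≤_) κ → t^ + d · runForm m d 0 κ ⊕ cornerFormAfterE m d κ ≐ cornerForm (suc m) d κ
cornerForm-suc m zero    []            pos       = ≐-refl
cornerForm-suc m (suc d) []            pos       = coeffwise λ i e → cong (λ b → [ b ]· _) (sym (≟-suc m d))
cornerForm-suc m zero    (suc c₀ ∷ κ) (_ ∷ pos) = coeffwise λ i e →
  trans (ℕ.+-identityʳ _) (cong₂ [_]·_ length-eq (sym (ℕ.+-identityʳ _)))
  where
  s = c₀ + sum κ
  length-eq : ⌊ m ℕ.≟ s + s + 1 ⌋ ≡ ⌊ suc m ℕ.≟ suc (s + suc s + 0) ⌋
  length-eq = sym (trans (≟-suc m _) (cong (λ n → ⌊ m ℕ.≟ n ⌋) (+-suc-middle s 0)))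
cornerForm-suc m (suc d) (suc c₀ ∷ κ) (_ ∷ pos) = coeffwise λ i e →
  trans (cong₂ (λ b n → [ b ]· ∏W (suc (suc d)) c₀ (runs ∏W n κ) i (e ℤ.- + suc d) + [ b₂ ]· runs ∏W (suc d) (suc c₀ ∷ κ) i e)
               b₁≡b (sym (ℕ.+-suc (suc d) c₀)))
  (trans (cong (λ b′ → [ b ]· _ + [ b′ ]· _) b₂≡b)
  (trans ([]·-+-comm b _ _)
         (cong [ b ]·_ (sym (at (⨁-suc (suc d) (λ a → t^ + a · ∏W (suc a) c₀ (runs ∏W (a + suc c₀) κ))) i e)))))
  where
  s = c₀ + sum κ
  b = ⌊ suc m ℕ.≟ suc s + suc s + suc d ⌋
  b₂ = ⌊ m ℕ.≟ suc s + suc s + d ⌋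
  b₁≡b : ⌊ m ℕ.≟ s + s + suc (suc d) ⌋ ≡ b
  b₁≡b = sym (trans (≟-suc m _) (cong (λ n → ⌊ m ℕ.≟ n ⌋) (+-suc-middle s (suc d))))
  b₂≡b : b₂ ≡ b
  b₂≡b = sym (trans (cong (λ n → ⌊ suc m ℕ.≟ n ⌋) (ℕ.+-suc (suc s + suc s) d)) (≟-suc m _))

runForm-suc : ∀ m p c κ → All (1 ≤_) κ → W (+ suc p) (runForm m (suc p) (suc c) κ) ⊕ runFormAfterE m p c κ ≐ runForm (suc m) p c κ
runForm-suc m p c []       pos       = ≐-refl
runForm-suc m p c (c₀ ∷ κ) (_ ∷ pos) with remaining c c₀ | remaining-suc c c₀ | ≟-remaining c c₀
... | nothing     | r | b rewrite r | b = ≐-refl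
... | just zero   | r | b rewrite r | b = coeffwise λ i e →
  cong₂ [_]·_ (trans (sym (≟-suc m _)) (cong (λ n → ⌊ suc m ℕ.≟ n ⌋) (sym (ℕ.+-suc (sum κ + sum κ) p))))
              (cong (λ n → runs ∏W n κ i e) (sym (ℕ.+-identityʳ (suc p))))
... | just (suc r) | r′ | b′ rewrite r′ | b′ = coeffwise λ i e →
  trans (ℕ.+-identityʳ _)
  (trans ([]·-+-comm bL (X i (e ℤ.- + suc p)) (X (i ℤ.- + 1) e))
  (trans (cong [ bL ]·_ (ℕ.+-comm (X (i ℤ.- + 1) e) (X i (e ℤ.- + suc p))))
         (cong₂ (λ b n → [ b ]· ∏W (suc p) (suc r) (runs ∏W n κ) i e) bL≡bR (sym (ℕ.+-suc (suc p) r)))))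
  where
  B′ = r + sum κ
  X : Series
  X = ∏W (suc (suc p)) r (runs ∏W (suc (suc p) + r) κ)
  bL = ⌊ m ℕ.≟ B′ + B′ + suc (suc p) ⌋
  bL≡bR : bL ≡ ⌊ suc m ℕ.≟ suc B′ + suc B′ + suc p ⌋
  bL≡bR = sym (trans (≟-suc m _) (cong (λ n → ⌊ m ℕ.≟ n ⌋) (+-suc-middle B′ (suc p))))

mutual
  pathSum-corner : ∀ m d p κ → d ≤ p → All (1 ≤_) κ → pathSum m d 0 p κ ≐ cornerForm m d κ
  pathSum-corner zero    zero    p []           _ _        = coeffwise λ i e → ℕ.+-identityʳ _
  pathSum-corner zero    zero    p (zero ∷ κ)   _ (() ∷ _)
  pathSum-corner zero    zero    p (suc c₀ ∷ κ) _ _        = ≐-refl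
  pathSum-corner zero    (suc d) p κ            _ _        = coeffwise λ i e → cong (λ b → [ b ]· runs ∏W (suc (suc d)) κ i e)
    (sym (⌊⌋-false (0 ℕ.≟ sum κ + sum κ + suc d) λ eq → ℕ.0≢1+n (trans eq (ℕ.+-suc _ d))))
  pathSum-corner (suc m) d       p κ            d≤p pos    = begin
    pathSum (suc m) d 0 p κ
      ≈⟨ pathSum-suc m d 0 p κ ⟩
    rowFactor p d (pathSum m (suc d) 1 d κ) ⊕ pathSumAfterE m d 0 p κ
      ≈⟨ ⊕-cong (≐-trans (rowFactor-≤ p d (pathSum m (suc d) 1 d κ) d≤p) (t^-cong (+ d) (pathSum-run m d 0 κ pos)))
                (pathSumAfterE-corner m d p κ d≤p pos) ⟩
    t^ + d · runForm m d 0 κ ⊕ cornerFormAfterE m d κ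
      ≈⟨ cornerForm-suc m d κ pos ⟩
    cornerForm (suc m) d κ ∎
    where open ≐-Reasoning

  pathSumAfterE-corner : ∀ m d p κ → d ≤ p → All (1 ≤_) κ → pathSumAfterE m d 0 p κ ≐ cornerFormAfterE m d κ
  pathSumAfterE-corner m zero    p κ _   _   = ≐-refl
  pathSumAfterE-corner m (suc d) p κ d<p pos = pathSum-corner m d p κ (ℕ.<⇒≤ d<p) pos

  pathSum-run : ∀ m p c κ → All (1 ≤_) κ → pathSum m (suc p) (suc c) p κ ≐ runForm m p c κ
  pathSum-run zero    p c []       _   = ≐-refl
  pathSum-run zero    p c (c₀ ∷ κ) _   = ≐-sym (runFormFrom-zero p (remaining c c₀) κ)
  pathSum-run (suc m) p c κ        pos = begin
    pathSum (suc m) (suc p) (suc c) p κ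
      ≈⟨ pathSum-suc m (suc p) (suc c) p κ ⟩
    rowFactor p (suc p) (pathSum m (suc (suc p)) (suc (suc c)) (suc p) κ) ⊕ pathSumAfterE m (suc p) (suc c) p κ
      ≈⟨ ⊕-cong (≐-trans (rowFactor-suc p (pathSum m (suc (suc p)) (suc (suc c)) (suc p) κ))
                         (W-cong (+ suc p) (pathSum-run m (suc p) (suc c) κ pos)))
                (pathSumAfterE-run m p c κ pos) ⟩
    W (+ suc p) (runForm m (suc p) (suc c) κ) ⊕ runFormAfterE m p c κ
      ≈⟨ runForm-suc m p c κ pos ⟩
    runForm (suc m) p c κ ∎
    where open ≐-Reasoning

  pathSumAfterE-run : ∀ m p c κ → All (1 ≤_) κ → pathSumAfterE m (suc p) (suc c) p κ ≐ runFormAfterE m p c κ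
  pathSumAfterE-run m p c []       _         = ≐-refl
  pathSumAfterE-run m p c (c₀ ∷ κ) (_ ∷ pos) = coeffwise λ i e →
    cong [ ⌊ suc c ℕ.≟ c₀ ⌋ ]·_ (at (pathSum-corner m p p κ ℕ.≤-refl pos) i e)

sorted-↭⇒≡ : ∀ {xs ys} → Linked _≤_ xs → Linked _≤_ ys → xs ↭ ys → xs ≡ ys
sorted-↭⇒≡ sx sy p = Pointwise-≡⇒≡ (↗↭↗⇒≋ ℕ.≤-totalOrder sx sy (Homogeneous.map (λ q → q) (↭⇒↭ₛ p)))

↭⇒sort-≡ : ∀ {xs ys} → xs ↭ ys → sort xs ≡ sort ys
↭⇒sort-≡ {xs} {ys} p = sorted-↭⇒≡ (Sort.sort-↗ xs) (Sort.sort-↗ ys)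
  (↭-trans (Sort.sort-↭ xs) (↭-trans p (↭-sym (Sort.sort-↭ ys))))

sort-≡⇒↭ : ∀ {xs ys} → sort xs ≡ sort ys → xs ↭ ys
sort-≡⇒↭ {xs} {ys} eq = ↭-trans (↭-sym (Sort.sort-↭ xs)) (subst (_↭ ys) (sym eq) (Sort.sort-↭ ys))

All-reverse : ∀ {P : ℕ → Set} {xs} → All P xs → All P (reverse xs)
All-reverse {xs = []}     []       = []
All-reverse {P} {x ∷ xs} (p ∷ ps) = subst (All P) (sym (List.unfold-reverse x xs)) (All.∷ʳ⁺ (All-reverse ps) p)

Linked-∷ʳ : ∀ {xs x} → Linked _≤_ xs → All (_≤ x) xs → Linked _≤_ (xs ∷ʳ x)
Linked-∷ʳ []      []       = [-]
Linked-∷ʳ [-]     (p ∷ []) = p ∷ [-]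
Linked-∷ʳ (r ∷ l) (p ∷ ps) = r ∷ Linked-∷ʳ l ps

reverse-decreasing : ∀ {xs} → Linked _≥_ xs → Linked _≤_ (reverse xs)
reverse-decreasing []                  = []
reverse-decreasing {x ∷ []}     [-]    = [-]
reverse-decreasing {x ∷ y ∷ xs} l@(_ ∷ l′) = subst (Linked _≤_) (sym (List.unfold-reverse x (y ∷ xs)))
  (Linked-∷ʳ (reverse-decreasing l′) (All-reverse (All.tail (Linked⇒All (λ p q → ℕ.≤-trans q p) ℕ.≤-refl l))))

reverse-sort-≡⇒↭ : ∀ {κ la} → reverse (sort κ) ≡ la → κ ↭ la
reverse-sort-≡⇒↭ {κ} refl = ↭-trans (↭-sym (Sort.sort-↭ κ)) (↭-sym (Perm.↭-reverse (sort κ)))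

↭⇒reverse-sort-≡ : ∀ {κ la} → Linked _≥_ la → κ ↭ la → reverse (sort κ) ≡ la
↭⇒reverse-sort-≡ {κ} {la} dec p = trans
  (cong reverse (sorted-↭⇒≡ (Sort.sort-↗ κ) (reverse-decreasing dec)
                  (↭-trans (Sort.sort-↭ κ) (↭-trans p (↭-sym (Perm.↭-reverse la))))))
  (List.reverse-involutive la)

zeros : List ℕ → ℕ
zeros []           = 0
zeros (zero  ∷ xs) = suc (zeros xs)
zeros (suc x ∷ xs) = zeros xs

↭-nonzeros-zeros : ∀ xs → xs ↭ nonzeros xs ++ replicate (zeros xs) 0
↭-nonzeros-zeros []           = ↭-refl
↭-nonzeros-zeros (zero  ∷ xs) = ↭-trans (prep 0 (↭-nonzeros-zeros xs)) (↭-sym (Perm.shift 0 (nonzeros xs) _))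
↭-nonzeros-zeros (suc x ∷ xs) = prep (suc x) (↭-nonzeros-zeros xs)

length-nonzeros-zeros : ∀ xs → length xs ≡ length (nonzeros xs) + zeros xs
length-nonzeros-zeros []           = refl
length-nonzeros-zeros (zero  ∷ xs) = trans (cong suc (length-nonzeros-zeros xs)) (sym (ℕ.+-suc _ _))
length-nonzeros-zeros (suc x ∷ xs) = cong suc (length-nonzeros-zeros xs)

nonzeros-↭ : ∀ {xs ys} → xs ↭ ys → nonzeros xs ↭ nonzeros ys
nonzeros-↭ refl                        = ↭-refl
nonzeros-↭ (prep zero    p)            = nonzeros-↭ p
nonzeros-↭ (prep (suc x) p)            = prep (suc x) (nonzeros-↭ p)
nonzeros-↭ (swap zero    zero    p)    = nonzeros-↭ p
nonzeros-↭ (swap zero    (suc y) p)    = prep (suc y) (nonzeros-↭ p)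
nonzeros-↭ (swap (suc x) zero    p)    = prep (suc x) (nonzeros-↭ p)
nonzeros-↭ (swap (suc x) (suc y) p)    = swap (suc x) (suc y) (nonzeros-↭ p)
nonzeros-↭ (↭-transitive p q)          = ↭-trans (nonzeros-↭ p) (nonzeros-↭ q)

nonzeros-++ : ∀ xs ys → nonzeros (xs ++ ys) ≡ nonzeros xs ++ nonzeros ys
nonzeros-++ []           ys = refl
nonzeros-++ (zero  ∷ xs) ys = nonzeros-++ xs ys
nonzeros-++ (suc x ∷ xs) ys = cong (suc x ∷_) (nonzeros-++ xs ys)

nonzeros-replicate-0 : ∀ m → nonzeros (replicate m 0) ≡ []
nonzeros-replicate-0 zero    = refl
nonzeros-replicate-0 (suc m) = nonzeros-replicate-0 m

nonzeros-positive : ∀ {la} → All (1 ≤_) la → nonzeros la ≡ la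
nonzeros-positive []                      = refl
nonzeros-positive {suc x ∷ la} (_ ∷ pos) = cong (suc x ∷_) (nonzeros-positive pos)

↭-padded⇒nonzeros-↭ : ∀ {bs la m} → All (1 ≤_) la → bs ↭ la ++ replicate m 0 → nonzeros bs ↭ la
↭-padded⇒nonzeros-↭ {bs} {la} {m} pos p = subst (nonzeros bs ↭_)
  (trans (nonzeros-++ la (replicate m 0)) (trans (cong₂ _++_ (nonzeros-positive pos) (nonzeros-replicate-0 m)) (List.++-identityʳ la)))
  (nonzeros-↭ p)

nonzeros-↭⇒↭-padded : ∀ {bs la k} → length bs ≡ suc k → nonzeros bs ↭ la → bs ↭ la ++ replicate (suc k ∸ length la) 0
nonzeros-↭⇒↭-padded {bs} {la} {k} len p =
  ↭-trans (↭-nonzeros-zeros bs) (Perm.++⁺ p (↭-reflexive (cong (λ z → replicate z 0) zeros≡)))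
  where
  zeros≡ : zeros bs ≡ suc k ∸ length la
  zeros≡ = trans (sym (ℕ.m+n∸m≡n (length (nonzeros bs)) (zeros bs)))
                 (cong₂ _∸_ (trans (sym (length-nonzeros-zeros bs)) len) (Perm.↭-length p))

isRearrangement≡partition-nonzeros : ∀ k la bs → All (1 ≤_) la → Linked _≥_ la → length bs ≡ suc k →
  isRearrangement bs (la ++ replicate (suc k ∸ length la) 0) ≡ (reverse (sort (nonzeros bs)) ≡ᵇ la)
isRearrangement≡partition-nonzeros k la bs pos dec len = ⌊⌋-⇔ (List.≡-dec ℕ._≟_ _ _) (List.≡-dec ℕ._≟_ _ _)
  (λ eq → ↭⇒reverse-sort-≡ {nonzeros bs} dec (↭-padded⇒nonzeros-↭ {bs} pos (sort-≡⇒↭ {bs} eq)))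
  (λ eq → ↭⇒sort-≡ {bs} (nonzeros-↭⇒↭-padded {bs} {la} {k} len (reverse-sort-≡⇒↭ {nonzeros bs} eq)))

∑-≡ᵇ-absent : ∀ {κ} (K : List (List ℕ)) n → All (κ ≢_) K → ∑[ κ′ ∈ K ] [ κ ≡ᵇ κ′ ]· n ≡ 0
∑-≡ᵇ-absent         []       n []           = refl
∑-≡ᵇ-absent {κ} (κ′ ∷ K) n (κ≢κ′ ∷ κ∉K) =
  cong₂ _+_ (cong (λ b → [ b ]· n) (⌊⌋-false (List.≡-dec ℕ._≟_ κ κ′) κ≢κ′)) (∑-≡ᵇ-absent K n κ∉K)

∑-≡ᵇ-unique : ∀ {κ} (K : List (List ℕ)) n → Unique K → κ ∈ K → ∑[ κ′ ∈ K ] [ κ ≡ᵇ κ′ ]· n ≡ n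
∑-≡ᵇ-unique {κ} (κ′ ∷ K) n (κ′∉K ∷ uniq) (here refl) = trans
  (cong₂ _+_ (cong (λ b → [ b ]· n) (⌊⌋-true (List.≡-dec ℕ._≟_ κ κ) refl)) (∑-≡ᵇ-absent K n κ′∉K))
  (ℕ.+-identityʳ n)
∑-≡ᵇ-unique {κ} (κ′ ∷ K) n (κ′∉K ∷ uniq) (there κ∈K) = cong₂ _+_
  (cong (λ b → [ b ]· n) (⌊⌋-false (List.≡-dec ℕ._≟_ κ κ′) λ κ≡κ′ → All.lookup κ′∉K κ∈K (sym κ≡κ′)))
  (∑-≡ᵇ-unique K n uniq κ∈K)

∑-fibres : ∀ (K : List (List ℕ)) (k : A → List ℕ) (X : List A) f → Unique K → (∀ {x} → x ∈ X → k x ∈ K) →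
  ∑ X f ≡ ∑[ κ ∈ K ] ∑[ x ∈ X ] [ k x ≡ᵇ κ ]· f x
∑-fibres K k X f uniq cover = sym (trans (∑-comm K X _)
  (∑-cong-All (All.tabulate cover) λ {x} kx∈K → ∑-≡ᵇ-unique K (f x) uniq kx∈K))

[≡ᵇ]·-fibre : ∀ (P : List ℕ → Bool) κ κ′ n → [ κ ≡ᵇ κ′ ]· [ P κ ]· n ≡ [ P κ′ ]· [ κ ≡ᵇ κ′ ]· n
[≡ᵇ]·-fibre P κ κ′ n with List.≡-dec ℕ._≟_ κ κ′
... | yes refl = refl
... | no  _    = sym ([]·-zero (P κ′))

∑-by-key : ∀ (kX : A → List ℕ) (kY : B → List ℕ) (f : A → ℕ) (g : B → ℕ) (P : List ℕ → Bool) X Y →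
  (∀ κ → P κ ≡ true → ∑[ x ∈ X ] [ kX x ≡ᵇ κ ]· f x ≡ ∑[ y ∈ Y ] [ kY y ≡ᵇ κ ]· g y) →
  ∑[ x ∈ X ] [ P (kX x) ]· f x ≡ ∑[ y ∈ Y ] [ P (kY y) ]· g y
∑-by-key kX kY f g P X Y fibres≡ = begin
  ∑[ x ∈ X ] [ P (kX x) ]· f x                        ≡⟨ byFibres kX f X (λ x∈X → ∈-deduplicate⁺ _≟_ (∈-++⁺ˡ (∈-map⁺ kX x∈X))) ⟩
  ∑[ κ ∈ K ] [ P κ ]· ∑[ x ∈ X ] [ kX x ≡ᵇ κ ]· f x   ≡⟨ ∑-cong K onKey ⟩
  ∑[ κ ∈ K ] [ P κ ]· ∑[ y ∈ Y ] [ kY y ≡ᵇ κ ]· g y   ≡⟨ byFibres kY g Y (λ y∈Y → ∈-deduplicate⁺ _≟_ (∈-++⁺ʳ _ (∈-map⁺ kY y∈Y))) ⟨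
  ∑[ y ∈ Y ] [ P (kY y) ]· g y                        ∎
  where
  open ≡-Reasoning
  _≟_ = List.≡-dec ℕ._≟_
  K = deduplicate _≟_ (map kX X ++ map kY Y)

  byFibres : ∀ {C : Set} (k : C → List ℕ) h Z → (∀ {z} → z ∈ Z → k z ∈ K) →
    ∑[ z ∈ Z ] [ P (k z) ]· h z ≡ ∑[ κ ∈ K ] [ P κ ]· ∑[ z ∈ Z ] [ k z ≡ᵇ κ ]· h z
  byFibres k h Z cover = trans (∑-fibres K k Z _ (deduplicate-! _≟_ _) cover)
    (∑-cong K λ κ → trans (∑-cong Z λ z → [≡ᵇ]·-fibre P (k z) κ (h z)) (∑-[]· (P κ) Z _))

  onKey : ∀ κ → [ P κ ]· ∑[ x ∈ X ] [ kX x ≡ᵇ κ ]· f x ≡ [ P κ ]· ∑[ y ∈ Y ] [ kY y ≡ᵇ κ ]· g y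
  onKey κ with P κ in Pκ
  ... | true  = fibres≡ κ Pκ
  ... | false = refl

≡ᵇ⇒≡ : ∀ xs ys → (xs ≡ᵇ ys) ≡ true → xs ≡ ys
≡ᵇ⇒≡ xs ys eq with List.≡-dec ℕ._≟_ xs ys | eq
... | yes xs≡ys | _  = xs≡ys
... | no  _     | ()

coeff≡∑δ : ∀ e p → coeff e p ≡ ∑[ x ∈ p ] δ x e
coeff≡∑δ e []      = refl
coeff≡∑δ e (x ∷ p) with x ℤ.≟ e
... | yes _ = cong suc (coeff≡∑δ e p)
... | no  _ = coeff≡∑δ e p

coeff-t^area-H : ∀ j D e → coeff e (shiftT (+ area D) (H j D)) ≡ U (+ 0) (t^ + area D · ⟦ prodFactors (areaSeq D) ⟧) (+ j) e
coeff-t^area-H j D e = begin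
  coeff e (shiftT (+ area D) (H j D))
    ≡⟨ coeff≡∑δ e (shiftT (+ area D) (H j D)) ⟩
  ∑[ x ∈ shiftT (+ area D) (H j D) ] δ x e
    ≡⟨ ∑-map (ℤ._+_ (+ area D)) (map proj₂ terms) (λ x → δ x e) ⟩
  ∑[ x ∈ map proj₂ terms ] δ (+ area D ℤ.+ x) e
    ≡⟨ ∑-map proj₂ terms (λ x → δ (+ area D ℤ.+ x) e) ⟩
  ∑[ m ∈ terms ] δ (+ area D ℤ.+ proj₂ m) e
    ≡⟨ ∑-filterᵇ (λ m → ⌊ proj₁ m ℕ.≟ j ⌋) (HPoly D) _ ⟩
  ∑[ m ∈ HPoly D ] [ ⌊ proj₁ m ℕ.≟ j ⌋ ]· δ (+ area D ℤ.+ proj₂ m) e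
    ≡⟨ ∑-cong (HPoly D) (λ m → cong₂ [_]·_
         (⌊⌋-⇔ (proj₁ m ℕ.≟ j) (+ proj₁ m ℤ.≟ + j) (cong (λ x → + x)) λ { refl → refl })
         (δ-shift (+ area D) (proj₂ m) e)) ⟩
  ⟦ binomial (+ 0) *B prodFactors (areaSeq D) ⟧ (+ j) (e ℤ.- + area D)
    ≡⟨ at (⟦binomial*B⟧ (+ 0) (prodFactors (areaSeq D))) (+ j) (e ℤ.- + area D) ⟩
  U (+ 0) ⟦ prodFactors (areaSeq D) ⟧ (+ j) (e ℤ.- + area D)
    ≡⟨ at (U-t^-comm (+ 0) (+ area D) ⟦ prodFactors (areaSeq D) ⟧) (+ j) e ⟨
  U (+ 0) (t^ + area D · ⟦ prodFactors (areaSeq D) ⟧) (+ j) e ∎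
  where
  open ≡-Reasoning
  terms = filterᵇ (λ m → ⌊ proj₁ m ℕ.≟ j ⌋) (HPoly D)

U-∑ : ∀ j {X : Set} (L : List X) (A B : X → Bool) (P : X → Series) →
  U j (λ i e → ∑[ w ∈ L ] [ A w ]· [ B w ]· P w i e) ≐ (λ i e → ∑[ w ∈ L ] [ A w ]· [ B w ]· U j (P w) i e)
U-∑ j L A B P = coeffwise λ i e → trans (sym (∑-+ L _ _))
  (∑-cong L λ w → trans (sym ([]·-+ (A w) _ _)) (cong [ A w ]·_ (sym ([]·-+ (B w) _ _))))

-- A Dyck path starts with a north step (area 0); the rest is a path counted by pathSum.
∑-Dyck-runs : ∀ n κ → 1 ≤ n → All (1 ≤_) κ → sum κ ≡ n → ∀ j e →
  ∑[ D ∈ Dyck n ] [ vRunsFrom 0 D ≡ᵇ κ ]· coeff e (shiftT (+ area D) (H j D)) ≡ W (+ 0) (runs ∏W 1 κ) (+ j) e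
∑-Dyck-runs (suc n) []           _ _         () j e
∑-Dyck-runs (suc n) (suc c₀ ∷ κ) _ (_ ∷ pos) Σκ≡n j e = begin
  ∑[ D ∈ Dyck (suc n) ] [ vRunsFrom 0 D ≡ᵇ κ₀ ]· f D
    ≡⟨ ∑-filterᵇ (weaklyAbove 0 0) (allWords (suc m)) _ ⟩
  ∑[ D ∈ allWords (suc m) ] [ weaklyAbove 0 0 D ]· [ vRunsFrom 0 D ≡ᵇ κ₀ ]· f D
    ≡⟨ ∑-concatMap (λ w → (true ∷ w) ∷ (false ∷ w) ∷ []) (allWords m) _ ⟩
  ∑[ w ∈ allWords m ] ([ weaklyAbove 1 0 w ]· [ vRunsFrom 1 w ≡ᵇ κ₀ ]· f (true ∷ w) + 0)
    ≡⟨ ∑-cong (allWords m) (λ w → trans (ℕ.+-identityʳ _) (cong (λ x → [ weaklyAbove 1 0 w ]· [ vRunsFrom 1 w ≡ᵇ κ₀ ]· x)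
         (trans (coeff-t^area-H j (true ∷ w) e) (at (U-cong (+ 0) (t^sum-⟦prodFactors⟧ 0 (areaSeqFrom 1 0 w))) (+ j) e)))) ⟩
  ∑[ w ∈ allWords m ] [ weaklyAbove 1 0 w ]· [ vRunsFrom 1 w ≡ᵇ κ₀ ]· U (+ 0) (rowProduct 0 (areaSeqFrom 1 0 w)) (+ j) e
    ≡⟨ at (U-∑ (+ 0) (allWords m) (weaklyAbove 1 0) (λ w → vRunsFrom 1 w ≡ᵇ κ₀) (λ w → rowProduct 0 (areaSeqFrom 1 0 w))) (+ j) e ⟨
  U (+ 0) (pathSum m 1 1 0 κ₀) (+ j) e
    ≡⟨ at (U-cong (+ 0) (pathSum-run m 0 0 κ₀ (s≤s z≤n ∷ pos))) (+ j) e ⟩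
  U (+ 0) ([ ⌊ m ℕ.≟ s + s + 1 ⌋ ]·ₛ R) (+ j) e
    ≡⟨ cong (λ b → [ b ]· R (+ j) e + [ b ]· R (+ j ℤ.- + 1) (e ℤ.- + 0)) (⌊⌋-true (m ℕ.≟ s + s + 1) length≡) ⟩
  R (+ j) e + R (+ j ℤ.- + 1) (e ℤ.- + 0)
    ≡⟨ cong₂ _+_ (trans (cong (R (+ j)) (−-zero-zero e)) (sym (ℕ.+-identityʳ _))) (sym (ℕ.+-identityʳ _)) ⟩
  W (+ 0) (runs ∏W 1 κ₀) (+ j) e ∎
  where
  open ≡-Reasoning
  κ₀ = suc c₀ ∷ κ
  m = n + suc n
  s = c₀ + sum κ
  R = ∏W 1 c₀ (runs ∏W (suc c₀) κ)
  f : List Bool → ℕ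
  f D = coeff e (shiftT (+ area D) (H j D))
  length≡ : m ≡ s + s + 1
  length≡ = trans (ℕ.+-suc n n) (trans (ℕ.+-comm 1 (n + n)) (cong (λ x → x + x + 1) (sym (ℕ.suc-injective Σκ≡n))))
  −-zero-zero : ∀ x → x ≡ x ℤ.- + 0 ℤ.- + 0
  −-zero-zero = solve-∀

allLists-length : ∀ m N → All (λ bs → length bs ≡ m) (allLists m N)
allLists-length zero    N = refl ∷ []
allLists-length (suc m) N = All.concat⁺ (All.map⁺ (All.universal (λ _ → All.map⁺ (All.map (cong suc) (allLists-length m N))) (upTo (suc N))))

All-≤-sum : ∀ κ → All (_≤ sum κ) κ
All-≤-sum []      = []
All-≤-sum (x ∷ κ) = ℕ.m≤m+n x (sum κ) ∷ All.map (λ p → ℕ.≤-trans p (ℕ.m≤n+m (sum κ) x)) (All-≤-sum κ)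

runsExcess≡ : ∀ κ → All (1 ≤_) κ → runsExcess κ ≡ + sum κ ℤ.- + length κ
runsExcess≡ []          _         = refl
runsExcess≡ (suc c ∷ κ) (_ ∷ pos) = trans (cong (ℤ._+_ (+ c)) (runsExcess≡ κ pos)) (lemma (+ c) (+ sum κ) (+ length κ))
  where
  lemma : ∀ c s l → c ℤ.+ (s ℤ.- l) ≡ (+ 1 ℤ.+ c ℤ.+ s) ℤ.- (+ 1 ℤ.+ l)
  lemma = solve-∀

-- The u-degree k + 1 - ℓ(κ) on the left becomes n - k on the right after reversing.
reversed-degree : ∀ n k κ → All (1 ≤_) κ → sum κ ≡ n → k ≤ n →
  runsExcess κ ℤ.+ + 1 ℤ.- (+ suc k ℤ.- + length κ) ≡ + (n ∸ k)
reversed-degree n k κ pos refl k≤n = begin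
  runsExcess κ ℤ.+ + 1 ℤ.- i        ≡⟨ cong (λ d → d ℤ.+ + 1 ℤ.- i) (runsExcess≡ κ pos) ⟩
  + n ℤ.- + length κ ℤ.+ + 1 ℤ.- i  ≡⟨ lemma (+ n) (+ length κ) (+ k) ⟩
  + n ℤ.- + k                       ≡⟨ cong (λ x → + x ℤ.- + k) (ℕ.m∸n+n≡m k≤n) ⟨
  + (n ∸ k + k) ℤ.- + k             ≡⟨ lemma′ (+ (n ∸ k)) (+ k) ⟩
  + (n ∸ k)                         ∎
  where
  open ≡-Reasoning
  i = + suc k ℤ.- + length κ
  lemma : ∀ n l k → n ℤ.- l ℤ.+ + 1 ℤ.- ((+ 1 ℤ.+ k) ℤ.- l) ≡ n ℤ.- k
  lemma = solve-∀
  lemma′ : ∀ a b → a ℤ.+ b ℤ.- b ≡ a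
  lemma′ = solve-∀

fibre-LHS≡RHS : ∀ n k κ → All (1 ≤_) κ → sum κ ≡ n → 1 ≤ k → k ≤ n → ∀ e →
  ∑[ bs ∈ allLists (suc k) n ] [ nonzeros bs ≡ᵇ κ ]· startBelowCount 1 bs e ≡
  ∑[ D ∈ Dyck n ] [ vRunsFrom 0 D ≡ᵇ κ ]· coeff e (shiftT (+ area D) (H (n ∸ k) D))
fibre-LHS≡RHS n k κ pos Σκ≡n 1≤k k≤n e = begin
  ∑[ bs ∈ allLists (suc k) n ] [ nonzeros bs ≡ᵇ κ ]· startBelowCount 1 bs e
    ≡⟨ ∑-nonzeros≡countM (suc k) n 1 κ pos (subst (λ s → All (_≤ s) κ) Σκ≡n (All-≤-sum κ)) e ⟩
  countM (suc k) 1 κ e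
    ≡⟨ countM≡G (suc k) 1 κ pos e ⟩
  G 1 κ (+ suc k ℤ.- + length κ) e
    ≡⟨ at (G-1≐reverseU κ) (+ suc k ℤ.- + length κ) e ⟩
  W (+ 0) (runs ∏W 1 κ) (runsExcess κ ℤ.+ + 1 ℤ.- (+ suc k ℤ.- + length κ)) e
    ≡⟨ cong (λ i → W (+ 0) (runs ∏W 1 κ) i e) (reversed-degree n k κ pos Σκ≡n k≤n) ⟩
  W (+ 0) (runs ∏W 1 κ) (+ (n ∸ k)) e
    ≡⟨ ∑-Dyck-runs n κ (ℕ.≤-trans 1≤k k≤n) pos Σκ≡n (n ∸ k) e ⟨
  ∑[ D ∈ Dyck n ] [ vRunsFrom 0 D ≡ᵇ κ ]· coeff e (shiftT (+ area D) (H (n ∸ k) D)) ∎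
  where open ≡-Reasoning

coeff-LHS : ∀ k la e → All (1 ≤_) la → Linked _≥_ la →
  coeff e (LHS la k) ≡ ∑[ bs ∈ allLists (suc k) (sum la) ] [ reverse (sort (nonzeros bs)) ≡ᵇ la ]· startBelowCount 1 bs e
coeff-LHS k la e pos dec = begin
  coeff e (LHS la k)
    ≡⟨ coeff≡∑δ e (LHS la k) ⟩
  ∑[ x ∈ LHS la k ] δ x e
    ≡⟨ ∑-map (λ s → + ρ s) (M la k) (λ x → δ x e) ⟩
  ∑[ s ∈ M la k ] δ (+ ρ s) e
    ≡⟨ ∑-concatMap (λ bs → map (λ as → zipPairs as bs) (aSeqs 0 bs)) (bSeqs la k) _ ⟩
  ∑[ bs ∈ bSeqs la k ] ∑[ s ∈ map (λ as → zipPairs as bs) (aSeqs 0 bs) ] δ (+ ρ s) e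
    ≡⟨ ∑-cong (bSeqs la k) (λ bs → ∑-map (λ as → zipPairs as bs) (aSeqs 0 bs) _) ⟩
  ∑[ bs ∈ bSeqs la k ] aSeqCount 0 bs e
    ≡⟨ ∑-filterᵇ (λ bs → isRearrangement bs (la ++ replicate (suc k ∸ length la) 0)) (allLists (suc k) (sum la)) _ ⟩
  ∑[ bs ∈ allLists (suc k) (sum la) ] [ isRearrangement bs (la ++ replicate (suc k ∸ length la) 0) ]· aSeqCount 0 bs e
    ≡⟨ ∑-cong-All (allLists-length (suc k) (sum la)) (λ {bs} len →
         cong₂ [_]·_ (isRearrangement≡partition-nonzeros k la bs pos dec len) (nonempty bs len)) ⟩
  ∑[ bs ∈ allLists (suc k) (sum la) ] [ reverse (sort (nonzeros bs)) ≡ᵇ la ]· startBelowCount 1 bs e ∎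
  where
  open ≡-Reasoning
  nonempty : ∀ bs → length bs ≡ suc k → aSeqCount 0 bs e ≡ startBelowCount 1 bs e
  nonempty (b ∷ bs) _ = sym (ℕ.+-identityʳ _)

coeff-RHS : ∀ n k la e → coeff e (RHS n la k) ≡ ∑[ D ∈ Dyck n ] [ partitionOf D ≡ᵇ la ]· coeff e (shiftT (+ area D) (H (n ∸ k) D))
coeff-RHS n k la e = begin
  coeff e (RHS n la k)
    ≡⟨ coeff≡∑δ e (RHS n la k) ⟩
  ∑[ x ∈ RHS n la k ] δ x e
    ≡⟨ ∑-concatMap summand (filterᵇ (λ D → partitionOf D ≡ᵇ la) (Dyck n)) (λ x → δ x e) ⟩
  ∑[ D ∈ filterᵇ (λ D → partitionOf D ≡ᵇ la) (Dyck n) ] ∑[ x ∈ summand D ] δ x e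
    ≡⟨ ∑-cong (filterᵇ (λ D → partitionOf D ≡ᵇ la) (Dyck n)) (λ D → coeff≡∑δ e (summand D)) ⟨
  ∑[ D ∈ filterᵇ (λ D → partitionOf D ≡ᵇ la) (Dyck n) ] coeff e (summand D)
    ≡⟨ ∑-filterᵇ (λ D → partitionOf D ≡ᵇ la) (Dyck n) (λ D → coeff e (summand D)) ⟩
  ∑[ D ∈ Dyck n ] [ partitionOf D ≡ᵇ la ]· coeff e (summand D) ∎
  where
  open ≡-Reasoning
  summand : List Bool → LPoly
  summand D = shiftT (+ area D) (H (n ∸ k) D)

mainTheorem3 : (n k : ℕ) (la : List ℕ) → 1 ≤ k → k ≤ n → IsPartition n la →
    LHS la k ≈P RHS n la k
mainTheorem3 n k la 1≤k k≤n (refl , pos , dec) e = begin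
  coeff e (LHS la k)
    ≡⟨ coeff-LHS k la e pos dec ⟩
  ∑[ bs ∈ allLists (suc k) n ] [ hasPartitionλ (nonzeros bs) ]· startBelowCount 1 bs e
    ≡⟨ ∑-by-key nonzeros (vRunsFrom 0) (λ bs → startBelowCount 1 bs e) summand hasPartitionλ (allLists (suc k) n) (Dyck n) fibres≡ ⟩
  ∑[ D ∈ Dyck n ] [ hasPartitionλ (vRunsFrom 0 D) ]· summand D
    ≡⟨ coeff-RHS n k la e ⟨
  coeff e (RHS n la k) ∎
  where
  open ≡-Reasoning
  hasPartitionλ : List ℕ → Bool
  hasPartitionλ κ = reverse (sort κ) ≡ᵇ la
  summand : List Bool → ℕ
  summand D = coeff e (shiftT (+ area D) (H (n ∸ k) D))
  fibres≡ : ∀ κ → hasPartitionλ κ ≡ true →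
    ∑[ bs ∈ allLists (suc k) n ] [ nonzeros bs ≡ᵇ κ ]· startBelowCount 1 bs e ≡ ∑[ D ∈ Dyck n ] [ vRunsFrom 0 D ≡ᵇ κ ]· summand D
  fibres≡ κ eq = fibre-LHS≡RHS n k κ (Perm.All-resp-↭ (↭-sym κ↭λ) pos) (sum-↭ κ↭λ) 1≤k k≤n e
    where κ↭λ = reverse-sort-≡⇒↭ (≡ᵇ⇒≡ (reverse (sort κ)) la eq)
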